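{- Let $G$ be a connected graph with $k\geq 1$ cut vertices and let $B$ be a block of $G$ containing $s\leq k$ cut vertices $w_1,\dots,w_s$ of $G$. For $i=1,\dots,s$, let $G_i$ be the maximal connected subgraph of $G$ with $V(G_i)\cap V(B)=\{w_i\}$. For $S\subseteq\{1,\dots,s\}$ write $w_S$ for the list of vertices $w_i$, $i\in S$, and $\pi_S=\prod_{i\in S}(f_{G_i}(w_i)-1)$ (with $\pi_\emptyset=1$). Then (i) for every $v_0\in V(B)$, $f_G(v_0)=\sum_{S\subseteq\{1,\dots,s\}} f_B(v_0,w_S)\,\pi_S$, i.e. $f_G(v_0)=f_B(v_0)+\sum_{i}f_B(v_0,w_i)(f_{G_i}(w_i)-1)+\sum_{i<j}f_B(v_0,w_i,w_j)(f_{G_i}(w_i)-1)(f_{G_j}(w_j)-1)+\cdots+f_B(v_0,w_1,\dots,w_s)\prod_{i=1}^s(f_{G_i}(w_i)-1)$; (ii) $F(G)=F(B)+\sum_{i=1}^s(F(G_i)-1)+\sum_{i=1}^s(f_B(w_i)-1)(f_{G_i}(w_i)-1)+\sum_{S\subseteq\{1,\dots,s\},\,|S|\geq 2} f_B(w_S)\,\pi_S$.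
   Context: All graphs are simple, finite and undirected. A connected subgraph of $G$ is a nonempty subgraph (vertex subset with a subset of edges among them) that is connected; distinct subgraphs are counted separately. $F(G)$ is the number of connected subgraphs of $G$; $f_G(v_1,\dots,v_\ell)$ is the number of connected subgraphs of $G$ containing all of $v_1,\dots,v_\ell$ (so $f_G(v)$ is the number containing $v$). A block is a maximal 2-connected subgraph (or a bridge). -}

module Defs where

open import Data.Nat using (ℕ; zero; suc; _<ᵇ_; _≤ᵇ_; _+_; _*_; _∸_; _≤_)
open import Data.Bool using (Bool; true; false; _∧_; _∨_; not; if_then_else_; T)
open import Data.Fin using (Fin; toℕ; _≟_)
open import Data.Vec using (Vec; []; _∷_; lookup; tabulate; fromList; replicate; zipWith)
open import Data.List using (List; []; _∷_; [_]; map; concatMap; allFin; length; filterᵇ)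
open import Data.Nat.ListAction using (sum; product)
open import Data.Bool.ListAction using (all; any)
open import Data.Product using (_×_; _,_; proj₁; proj₂; ∃)
open import Relation.Nullary.Decidable using (⌊_⌋)
open import Relation.Binary.PropositionalEquality using (_≡_)

-- Ambient vertex set Fin n.  Potential edges = unordered pairs {i,j},
-- encoded as (i , j) with i < j.  Hence every graph here is simple,
-- finite and undirected.

pairs : ∀ n → List (Fin n × Fin n)
pairs n = concatMap (λ i → concatMap (λ j → if toℕ i <ᵇ toℕ j then [ (i , j) ] else []) (allFin n)) (allFin n)

P : ℕ → ℕ
P n = length (pairs n)

ends : ∀ {n} → Fin (P n) → Fin n × Fin n
ends {n} e = lookup (fromList (pairs n)) e

record SG (n : ℕ) : Set where
  constructor sg
  field
    V : Vec Bool n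
    E : Vec Bool (P n)
open SG public

allSubsets : ∀ m → List (Vec Bool m)
allSubsets zero = [ [] ]
allSubsets (suc m) = concatMap (λ X → (true ∷ X) ∷ (false ∷ X) ∷ []) (allSubsets m)

_⊆ᵇ_ : ∀ {m} → Vec Bool m → Vec Bool m → Bool
X ⊆ᵇ Y = all (λ i → not (lookup X i) ∨ lookup Y i) (allFin _)

nonemptyᵇ : ∀ {m} → Vec Bool m → Bool
nonemptyᵇ X = any (lookup X) (allFin _)

singletonV : ∀ {m} → Fin m → Vec Bool m
singletonV v = tabulate (λ u → ⌊ u ≟ v ⌋)

_∩_ : ∀ {m} → Vec Bool m → Vec Bool m → Vec Bool m
X ∩ Y = zipWith _∧_ X Y

_∪_ : ∀ {m} → Vec Bool m → Vec Bool m → Vec Bool m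
X ∪ Y = zipWith _∨_ X Y

countᵇ : ∀ {A : Set} → (A → Bool) → List A → ℕ
countᵇ p xs = length (filterᵇ p xs)

wf : ∀ {n} → SG n → Bool
wf H = all (λ e → not (lookup (E H) e) ∨ (lookup (V H) (proj₁ (ends e)) ∧ lookup (V H) (proj₂ (ends e)))) (allFin _)

_≼_ : ∀ {n} → SG n → SG n → Bool
H ≼ H' = (V H ⊆ᵇ V H') ∧ (E H ⊆ᵇ E H')

crosses : ∀ {n} → SG n → Vec Bool n → Bool
crosses H X = any (λ e → lookup (E H) e ∧
  (let a = proj₁ (ends e) ; b = proj₂ (ends e) in
   (lookup X a ∧ lookup (V H) b ∧ not (lookup X b)) ∨
   (lookup X b ∧ lookup (V H) a ∧ not (lookup X a)))) (allFin _)

connected : ∀ {n} → SG n → Bool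
connected H = nonemptyᵇ (V H) ∧
  all (λ X → not ((X ⊆ᵇ V H) ∧ nonemptyᵇ X ∧ not (V H ⊆ᵇ X)) ∨ crosses H X) (allSubsets _)

deleteVertex : ∀ {n} → SG n → Fin n → SG n
deleteVertex H v = sg (tabulate (λ u → lookup (V H) u ∧ not ⌊ u ≟ v ⌋))
                      (tabulate (λ e → lookup (E H) e ∧ not ⌊ proj₁ (ends e) ≟ v ⌋ ∧ not ⌊ proj₂ (ends e) ≟ v ⌋))

deleteEdge : ∀ {n} → SG n → Fin (P n) → SG n
deleteEdge H e = sg (V H) (tabulate (λ e' → lookup (E H) e' ∧ not ⌊ e' ≟ e ⌋))

isCut : ∀ {n} → SG n → Fin n → Bool
isCut H v = lookup (V H) v ∧ nonemptyᵇ (V (deleteVertex H v)) ∧ not (connected (deleteVertex H v))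

numCut : ∀ {n} → SG n → ℕ
numCut H = countᵇ (isCut H) (allFin _)

twoConnected : ∀ {n} → SG n → Bool
twoConnected H = (3 ≤ᵇ countᵇ (lookup (V H)) (allFin _)) ∧ connected H ∧
  all (λ v → not (lookup (V H) v) ∨ connected (deleteVertex H v)) (allFin _)

data IsBlock {n : ℕ} (G B : SG n) : Set where
  maximal2conn : T (wf B) → T (B ≼ G) → T (twoConnected B) →
    (∀ H → T (wf H) → T (H ≼ G) → T (B ≼ H) → T (twoConnected H) → H ≡ B) →
    IsBlock G B
  bridge : (e : Fin (P n)) → T (lookup (E G) e) →
    V B ≡ (singletonV (proj₁ (ends e)) ∪ singletonV (proj₂ (ends e))) →
    E B ≡ singletonV e → T (not (connected (deleteEdge G e))) → IsBlock G B

fc : ∀ {n} → SG n → List (Fin n) → ℕ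
fc {n} H ws = sum (map (λ V' → countᵇ (λ E' → let K = sg V' E' in
                 wf K ∧ (K ≼ H) ∧ connected K ∧ all (lookup V') ws) (allSubsets (P n)))
              (allSubsets n))

Fc : ∀ {n} → SG n → ℕ
Fc H = fc H []

whole : ∀ n → Vec Bool (P n) → SG n
whole n EG = sg (replicate _ true) EG

select : ∀ {s} → Vec Bool s → List (Fin s)
select S = filterᵇ (lookup S) (allFin _)

-- G is the union of B and the branches G_i, which are pairwise vertex-disjoint, edge-disjoint from B
-- and meet B only in w_i. This rests on the ear property of a block: no walk avoiding E(B) joins two
-- vertices of B (B plus such a path would be a larger 2-connected subgraph, or would bypass the bridge).
-- Hence an edge leaving B at x makes x a cut vertex, i.e. x = w_i, so everything outside B hangs off
-- some w_i.
--
-- Gluing C to A at a single vertex w, a connected subgraph K of A ∪ C either lies in A, or splits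
-- as (K ∩ A) ∪ (K ∩ C) with both parts connected, through w, and K ∩ C ≠ {w}, or lies in C − w.
-- Counting the three kinds gives
--   f_{A∪C}(ws) = f_A(ws) + f_A(ws, w) (f_C(w) − 1)          for nonempty ws ⊆ V(A),
--   F(A ∪ C)    = F(A) + f_A(w) (f_C(w) − 1) + (F(C) − f_C(w)).
-- Attaching the G_i one at a time, induction gives (i) and
--   F(G) = F(B) + Σ_i (F(G_i) − f_{G_i}(w_i)) + Σ_{S ≠ ∅} f_B(w_S) π_S,
-- and (ii) follows by splitting off the singletons S = {i}.

module Submission where

open import Defs
open import Data.Bool using (Bool; true; false; _∧_; _∨_; not; T; if_then_else_)
open import Data.Bool.ListAction using (all; any)
open import Data.Bool.Properties using (T-∧; T-∨; T-≡)
open import Data.Empty using (⊥; ⊥-elim)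
open import Data.Fin using (Fin; _≟_; toℕ) renaming (zero to fzero; suc to fsuc)
open import Data.Fin.Properties using (suc-injective)
open import Data.Fin.Subset using (⁅_⁆)
open import Data.List using (List; []; _∷_; [_]; _++_; allFin; length; concatMap; map; filterᵇ; cartesianProduct)
open import Data.List.Membership.Propositional using (_∈_)
open import Data.List.Membership.Propositional.Properties
  using (∈-concatMap⁺; ∈-concatMap⁻; ∈-∃++; ∈-++⁻; ∈-++⁺ˡ; ∈-++⁺ʳ; ∈-map⁺; ∈-map⁻; ∈-filter⁺; ∈-filter⁻; ∈-cartesianProduct⁺)
open import Data.List.Properties using (length-++; length-map; map-++; map-∘; map-tabulate; ++-assoc; ++-identityʳ)
open import Data.List.Relation.Binary.Subset.Propositional using (_⊆_)
open import Data.List.Relation.Unary.All using (All; []; _∷_)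
open import Data.List.Relation.Unary.All.Properties using (¬Any⇒All¬; All¬⇒¬Any)
open import Data.List.Relation.Unary.AllPairs using ([]; _∷_)
open import Data.List.Relation.Unary.Any using (here; there)
open import Data.List.Relation.Unary.Unique.Propositional using (Unique)
open import Data.Nat using (ℕ; zero; suc; _+_; _*_; _∸_; _≤_; _<_; _≤ᵇ_; _<ᵇ_; z≤n; s≤s)
open import Data.Nat.ListAction using (sum; product)
open import Data.Nat.ListAction.Properties using (sum-++)
open import Data.Nat.Properties
  using (+-suc; +-comm; +-assoc; +-identityʳ; *-comm; *-assoc; *-identityʳ; *-distribʳ-+; +-commutativeSemigroup;
         ≤-trans; ≤-antisym; <-irrefl; m≤n⇒m≤1+n; m≤n⇒∃[o]m+o≡n; m+n∸m≡n; ≤ᵇ⇒≤; ≤⇒≤ᵇ; <ᵇ⇒<)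
open import Data.Nat.Solver using (module +-*-Solver)
open import Algebra.Properties.CommutativeSemigroup +-commutativeSemigroup using (interchange)
open import Data.Product using (_×_; _,_; proj₁; proj₂; ∃; Σ)
open import Data.Sum using (_⊎_; inj₁; inj₂; [_,_]′; swap)
open import Data.Unit using (⊤; tt)
open import Data.Vec using (Vec; []; _∷_; lookup; tabulate; replicate; fromList)
open import Data.Vec.Properties using (lookup∘tabulate; lookup-zipWith; tabulate∘lookup; tabulate-cong; lookup-replicate)
open import Effect.Monad using (RawMonad)
open import Function.Base using (_∘_; id)
open import Function.Bundles using (Equivalence; _⇔_; mk⇔)
open import Relation.Binary.PropositionalEquality
  using (_≡_; _≢_; refl; sym; trans; subst; subst₂; cong; cong₂; module ≡-Reasoning)
open import Relation.Nullary using (¬_; Dec; yes; no)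
open import Relation.Nullary.Decidable
  using (⌊_⌋; T?; does-⇔; toWitness; fromWitness; decidable-stable; ¬¬-excluded-middle)
open import Relation.Nullary.Negation using (¬¬-Monad)
import Data.List.Membership.DecPropositional as DecMembership
import Data.List.Relation.Unary.All as All
import Data.List.Relation.Unary.All.Properties as All
import Data.List.Relation.Unary.Any as Any
import Data.List.Relation.Unary.Any.Properties as Any
import Data.List.Relation.Unary.Unique.Propositional.Properties as Unique
import Data.Product
import Data.Sum
open Equivalence using (to; from)
open ≡-Reasoning

-- Boolean reflection and finite sets

T-not⁻ : ∀ {a} → T (not a) → ¬ T a
T-not⁻ {true} ()

T-not⁺ : ∀ {a} → ¬ T a → T (not a)
T-not⁺ {true} ¬t = ¬t tt
T-not⁺ {false} _ = tt

T-ext : ∀ {a b} → (T a → T b) → (T b → T a) → a ≡ b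
T-ext {a} {b} f g = does-⇔ (mk⇔ f g) (T? a) (T? b)

T-all⁻ : ∀ {A : Set} (p : A → Bool) {xs} → T (all p xs) → ∀ {x} → x ∈ xs → T (p x)
T-all⁻ p t = All.lookup (All.all⁺ p _ t)

T-all⁺ : ∀ {A : Set} (p : A → Bool) {xs} → (∀ {x} → x ∈ xs → T (p x)) → T (all p xs)
T-all⁺ p f = All.all⁻ p (All.tabulate f)

T-allFin⁻ : ∀ {m} (p : Fin m → Bool) → T (all p (allFin m)) → ∀ i → T (p i)
T-allFin⁻ p t = All.tabulate⁻ (All.all⁺ p _ t)

T-allFin⁺ : ∀ {m} (p : Fin m → Bool) → (∀ i → T (p i)) → T (all p (allFin m))
T-allFin⁺ p f = All.all⁻ p (All.tabulate⁺ f)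

T-anyFin⁻ : ∀ {m} (p : Fin m → Bool) → T (any p (allFin m)) → ∃ λ i → T (p i)
T-anyFin⁻ p t = Any.tabulate⁻ (Any.any⁻ p _ t)

T-anyFin⁺ : ∀ {m} (p : Fin m → Bool) i → T (p i) → T (any p (allFin m))
T-anyFin⁺ p i t = Any.any⁺ p (Any.tabulate⁺ i t)

T-∃Fin? : ∀ {m} (p : Fin m → Bool) → (∃ λ i → T (p i)) ⊎ (∀ i → ¬ T (p i))
T-∃Fin? p with T? (any p (allFin _))
... | yes t = inj₁ (T-anyFin⁻ p t)
... | no ¬t = inj₂ (λ i pi → ¬t (T-anyFin⁺ p i pi))

T-∀Fin-counterexample : ∀ {m} (p : Fin m → Bool) → ¬ T (all p (allFin m)) → ∃ λ i → ¬ T (p i)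
T-∀Fin-counterexample p ¬t with T-∃Fin? (λ i → not (p i))
... | inj₁ (i , t) = i , T-not⁻ t
... | inj₂ none = ⊥-elim (¬t (T-allFin⁺ p λ i → decidable-stable (T? (p i)) (none i ∘ T-not⁺)))

infix 4 _∈ₛ_ _⊆ₛ_

_∈ₛ_ : ∀ {m} → Fin m → Vec Bool m → Set
i ∈ₛ X = T (lookup X i)

_⊆ₛ_ : ∀ {m} → Vec Bool m → Vec Bool m → Set
X ⊆ₛ Y = ∀ i → i ∈ₛ X → i ∈ₛ Y

module _ {m : ℕ} (X Y : Vec Bool m) (i : Fin m) where

  ∈-∪⁻ : i ∈ₛ X ∪ Y → i ∈ₛ X ⊎ i ∈ₛ Y
  ∈-∪⁻ t rewrite lookup-zipWith _∨_ i X Y = to T-∨ t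

  ∈-∪⁺ˡ : i ∈ₛ X → i ∈ₛ X ∪ Y
  ∈-∪⁺ˡ t rewrite lookup-zipWith _∨_ i X Y = from T-∨ (inj₁ t)

  ∈-∪⁺ʳ : i ∈ₛ Y → i ∈ₛ X ∪ Y
  ∈-∪⁺ʳ t rewrite lookup-zipWith _∨_ i X Y = from (T-∨ {lookup X i}) (inj₂ t)

  ∈-∩⁻ : i ∈ₛ X ∩ Y → i ∈ₛ X × i ∈ₛ Y
  ∈-∩⁻ t rewrite lookup-zipWith _∧_ i X Y = to T-∧ t

  ∈-∩⁺ : i ∈ₛ X → i ∈ₛ Y → i ∈ₛ X ∩ Y
  ∈-∩⁺ s t rewrite lookup-zipWith _∧_ i X Y = from T-∧ (s , t)

module _ {m : ℕ} (f : Fin m → Bool) (i : Fin m) where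

  ∈-tabulate⁻ : i ∈ₛ tabulate f → T (f i)
  ∈-tabulate⁻ t rewrite lookup∘tabulate f i = t

  ∈-tabulate⁺ : T (f i) → i ∈ₛ tabulate f
  ∈-tabulate⁺ t rewrite lookup∘tabulate f i = t

∈-singletonV⁻ : ∀ {m} (v i : Fin m) → i ∈ₛ singletonV v → i ≡ v
∈-singletonV⁻ v i t = toWitness (∈-tabulate⁻ (λ u → ⌊ u ≟ v ⌋) i t)

∈-singletonV⁺ : ∀ {m} (v : Fin m) → v ∈ₛ singletonV v
∈-singletonV⁺ v = ∈-tabulate⁺ (λ u → ⌊ u ≟ v ⌋) v (fromWitness refl)

∈-full : ∀ {m} (i : Fin m) → i ∈ₛ replicate m true
∈-full i rewrite lookup-replicate i true = tt

∉-empty : ∀ {m} (i : Fin m) → ¬ i ∈ₛ replicate m false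
∉-empty i t rewrite lookup-replicate i false = t

⊆ₛ-antisym : ∀ {m} {X Y : Vec Bool m} → X ⊆ₛ Y → Y ⊆ₛ X → X ≡ Y
⊆ₛ-antisym {X = X} {Y} f g =
  trans (sym (tabulate∘lookup X)) (trans (tabulate-cong (λ i → T-ext (f i) (g i))) (tabulate∘lookup Y))

⊆ᵇ⇒⊆ₛ : ∀ {m} (X Y : Vec Bool m) → T (X ⊆ᵇ Y) → X ⊆ₛ Y
⊆ᵇ⇒⊆ₛ X Y t i i∈X with to T-∨ (T-allFin⁻ (λ i → not (lookup X i) ∨ lookup Y i) t i)
... | inj₁ i∉X = ⊥-elim (T-not⁻ i∉X i∈X)
... | inj₂ i∈Y = i∈Y

⊆ₛ⇒⊆ᵇ : ∀ {m} (X Y : Vec Bool m) → X ⊆ₛ Y → T (X ⊆ᵇ Y)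
⊆ₛ⇒⊆ᵇ X Y X⊆Y = T-allFin⁺ (λ i → not (lookup X i) ∨ lookup Y i) pointwise
  where
  pointwise : ∀ i → T (not (lookup X i) ∨ lookup Y i)
  pointwise i with T? (lookup X i)
  ... | yes i∈X = from (T-∨ {not (lookup X i)}) (inj₂ (X⊆Y i i∈X))
  ... | no i∉X = from T-∨ (inj₁ (T-not⁺ i∉X))

⊈ᵇ⇒witness : ∀ {m} (X Y : Vec Bool m) → ¬ T (X ⊆ᵇ Y) → ∃ λ i → i ∈ₛ X × ¬ i ∈ₛ Y
⊈ᵇ⇒witness X Y ¬t with T-∀Fin-counterexample (λ i → not (lookup X i) ∨ lookup Y i) ¬t
... | i , ¬pi = i , decidable-stable (T? (lookup X i)) (λ i∉X → ¬pi (from T-∨ (inj₁ (T-not⁺ i∉X))))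
                  , (λ i∈Y → ¬pi (from (T-∨ {not (lookup X i)}) (inj₂ i∈Y)))

nonemptyᵇ⇒∃ : ∀ {m} (X : Vec Bool m) → T (nonemptyᵇ X) → ∃ λ i → i ∈ₛ X
nonemptyᵇ⇒∃ X = T-anyFin⁻ (lookup X)

∃⇒nonemptyᵇ : ∀ {m} (X : Vec Bool m) {i} → i ∈ₛ X → T (nonemptyᵇ X)
∃⇒nonemptyᵇ X {i} = T-anyFin⁺ (lookup X) i

∈-allSubsets : ∀ {m} (X : Vec Bool m) → X ∈ allSubsets m
∈-allSubsets [] = here refl
∈-allSubsets {suc m} (b ∷ X) = ∈-concatMap⁺ _ (Any.map (λ { refl → ∈-pair b }) (∈-allSubsets X))
  where
  ∈-pair : ∀ b → (b ∷ X) ∈ (true ∷ X) ∷ (false ∷ X) ∷ []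
  ∈-pair true = here refl
  ∈-pair false = there (here refl)

-- Constructively a predicate on Fin m has a characteristic vector only up to double negation;
-- that suffices wherever the goal is ⊥ or a Boolean fact.
¬¬-characteristic : ∀ m (Q : Fin m → Set) → ¬ ¬ (Σ (Vec Bool m) λ R → ∀ i → i ∈ₛ R ⇔ Q i)
¬¬-characteristic zero Q ¬R = ¬R ([] , λ ())
¬¬-characteristic (suc m) Q =
  ¬¬-excluded-middle >>= λ Q0? → ¬¬-characteristic m (λ i → Q (fsuc i)) >>= λ (R , R⇔Q) → pure (extend Q0? R R⇔Q)
  where
  open RawMonad ¬¬-Monad
  extend : Dec (Q fzero) → (R : Vec Bool m) → (∀ i → i ∈ₛ R ⇔ Q (fsuc i)) →
           Σ (Vec Bool (suc m)) λ R′ → ∀ i → i ∈ₛ R′ ⇔ Q i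
  extend (yes q) R R⇔Q = true ∷ R , λ { fzero → mk⇔ (λ _ → q) (λ _ → tt) ; (fsuc i) → R⇔Q i }
  extend (no ¬q) R R⇔Q = false ∷ R , λ { fzero → mk⇔ (λ ()) ¬q ; (fsuc i) → R⇔Q i }

module _ {m : ℕ} {X Y Z : Vec Bool m} where

  ∩-∪-distrib-cover : X ⊆ₛ Y ∪ Z → (X ∩ Y) ∪ (X ∩ Z) ≡ X
  ∩-∪-distrib-cover X⊆Y∪Z = ⊆ₛ-antisym
    (λ i t → [ (λ t′ → proj₁ (∈-∩⁻ X Y i t′)) , (λ t′ → proj₁ (∈-∩⁻ X Z i t′)) ]′ (∈-∪⁻ (X ∩ Y) (X ∩ Z) i t))
    (λ i i∈X → [ (λ i∈Y → ∈-∪⁺ˡ (X ∩ Y) (X ∩ Z) i (∈-∩⁺ X Y i i∈X i∈Y))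
               , (λ i∈Z → ∈-∪⁺ʳ (X ∩ Y) (X ∩ Z) i (∈-∩⁺ X Z i i∈X i∈Z)) ]′ (∈-∪⁻ Y Z i (X⊆Y∪Z i i∈X)))

  ∪-∩-absorbˡ : X ⊆ₛ Z → (∀ i → i ∈ₛ Y → i ∈ₛ Z → i ∈ₛ X) → (X ∪ Y) ∩ Z ≡ X
  ∪-∩-absorbˡ X⊆Z Y∩Z⊆X = ⊆ₛ-antisym
    (λ i t → let i∈X∪Y , i∈Z = ∈-∩⁻ (X ∪ Y) Z i t in [ (λ i∈X → i∈X) , (λ i∈Y → Y∩Z⊆X i i∈Y i∈Z) ]′ (∈-∪⁻ X Y i i∈X∪Y))
    (λ i i∈X → ∈-∩⁺ (X ∪ Y) Z i (∈-∪⁺ˡ X Y i i∈X) (X⊆Z i i∈X))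

  ∪-∩-absorbʳ : Y ⊆ₛ Z → (∀ i → i ∈ₛ X → i ∈ₛ Z → i ∈ₛ Y) → (X ∪ Y) ∩ Z ≡ Y
  ∪-∩-absorbʳ Y⊆Z X∩Z⊆Y = ⊆ₛ-antisym
    (λ i t → let i∈X∪Y , i∈Z = ∈-∩⁻ (X ∪ Y) Z i t in [ (λ i∈X → X∩Z⊆Y i i∈X i∈Z) , (λ i∈Y → i∈Y) ]′ (∈-∪⁻ X Y i i∈X∪Y))
    (λ i i∈Y → ∈-∩⁺ (X ∪ Y) Z i (∈-∪⁺ʳ X Y i i∈Y) (Y⊆Z i i∈Y))

listSet : ∀ {m} → List (Fin m) → Vec Bool m
listSet l = tabulate (λ u → any (λ z → ⌊ u ≟ z ⌋) l)

∈-listSet⁻ : ∀ {m} (l : List (Fin m)) u → u ∈ₛ listSet l → u ∈ l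
∈-listSet⁻ l u t = Any.map toWitness (Any.any⁻ _ l (∈-tabulate⁻ (λ u → any (λ z → ⌊ u ≟ z ⌋) l) u t))

∈-listSet⁺ : ∀ {m} (l : List (Fin m)) u → u ∈ l → u ∈ₛ listSet l
∈-listSet⁺ l u u∈l = ∈-tabulate⁺ (λ u → any (λ z → ⌊ u ≟ z ⌋) l) u (Any.any⁺ _ (Any.map fromWitness u∈l))

-- Subgraphs, connectivity and walks

private
  lookup-fromList-∈ : ∀ {A : Set} (xs : List A) i → lookup (fromList xs) i ∈ xs
  lookup-fromList-∈ (x ∷ xs) fzero = here refl
  lookup-fromList-∈ (x ∷ xs) (fsuc i) = there (lookup-fromList-∈ xs i)

pairs-ordered : ∀ n {i j : Fin n} → (i , j) ∈ pairs n → toℕ i < toℕ j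
pairs-ordered n m with Any.satisfied (∈-concatMap⁻ _ {xs = allFin n} m)
... | a , m′ with Any.satisfied (∈-concatMap⁻ _ {xs = allFin n} m′)
... | b , m″ = kept m″
  where
  kept : ∀ {i j} → (i , j) ∈ (if toℕ a <ᵇ toℕ b then [ (a , b) ] else []) → toℕ i < toℕ j
  kept m with toℕ a <ᵇ toℕ b in a<b
  kept (here refl) | true = <ᵇ⇒< _ _ (subst T (sym a<b) tt)

ends-distinct : ∀ {n} (e : Fin (P n)) → proj₁ (ends e) ≢ proj₂ (ends e)
ends-distinct {n} e eq = <-irrefl (cong toℕ eq) (pairs-ordered n (lookup-fromList-∈ (pairs n) e))

module _ {n : ℕ} where

  end₁ end₂ : Fin (P n) → Fin n
  end₁ e = proj₁ (ends e)
  end₂ e = proj₂ (ends e)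

  infix 4 _∈V_ _∈E_ _⊑_

  _∈V_ : Fin n → SG n → Set
  v ∈V H = v ∈ₛ V H

  _∈E_ : Fin (P n) → SG n → Set
  e ∈E H = e ∈ₛ E H

  _⊑_ : SG n → SG n → Set
  H ⊑ K = V H ⊆ₛ V K × E H ⊆ₛ E K

  ⊑-refl : ∀ {H} → H ⊑ H
  ⊑-refl = (λ _ t → t) , (λ _ t → t)

  ⊑-trans : ∀ {H K L} → H ⊑ K → K ⊑ L → H ⊑ L
  ⊑-trans (v₁ , e₁) (v₂ , e₂) = (λ i t → v₂ i (v₁ i t)) , (λ i t → e₂ i (e₁ i t))

  ≼⇒⊑ : ∀ {H K} → T (H ≼ K) → H ⊑ K
  ≼⇒⊑ {H} {K} t = ⊆ᵇ⇒⊆ₛ (V H) (V K) (proj₁ (to T-∧ t)) , ⊆ᵇ⇒⊆ₛ (E H) (E K) (proj₂ (to (T-∧ {V H ⊆ᵇ V K}) t))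

  ⊑⇒≼ : ∀ {H K} → H ⊑ K → T (H ≼ K)
  ⊑⇒≼ {H} {K} (v , e) = from T-∧ (⊆ₛ⇒⊆ᵇ (V H) (V K) v , ⊆ₛ⇒⊆ᵇ (E H) (E K) e)

  ⋢⇒witness : ∀ {H K} → ¬ T (H ≼ K) → (∃ λ v → v ∈V H × ¬ v ∈V K) ⊎ (∃ λ e → e ∈E H × ¬ e ∈E K)
  ⋢⇒witness {H} {K} ¬t with T? (V H ⊆ᵇ V K) | T? (E H ⊆ᵇ E K)
  ... | no ¬v | _ = inj₁ (⊈ᵇ⇒witness (V H) (V K) ¬v)
  ... | yes _ | no ¬e = inj₂ (⊈ᵇ⇒witness (E H) (E K) ¬e)
  ... | yes v | yes e = ⊥-elim (¬t (from T-∧ (v , e)))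

  graph-ext : ∀ {H K : SG n} → V H ≡ V K → E H ≡ E K → H ≡ K
  graph-ext {sg _ _} {sg _ _} refl refl = refl

  ⊑-antisym : ∀ {H K} → H ⊑ K → K ⊑ H → H ≡ K
  ⊑-antisym (v₁ , e₁) (v₂ , e₂) = graph-ext (⊆ₛ-antisym v₁ v₂) (⊆ₛ-antisym e₁ e₂)

  WellFormed : SG n → Set
  WellFormed H = ∀ e → e ∈E H → end₁ e ∈V H × end₂ e ∈V H

  wf⇒WellFormed : ∀ {H} → T (wf H) → WellFormed H
  wf⇒WellFormed {H} t e e∈H
    with to T-∨ (T-allFin⁻ (λ e → not (lookup (E H) e) ∨ (lookup (V H) (end₁ e) ∧ lookup (V H) (end₂ e))) t e)
  ... | inj₁ e∉H = ⊥-elim (T-not⁻ e∉H e∈H)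
  ... | inj₂ ends∈H = to T-∧ ends∈H

  WellFormed⇒wf : ∀ {H} → WellFormed H → T (wf H)
  WellFormed⇒wf {H} wfH = T-allFin⁺ _ pointwise
    where
    pointwise : ∀ e → T (not (lookup (E H) e) ∨ (lookup (V H) (end₁ e) ∧ lookup (V H) (end₂ e)))
    pointwise e with T? (lookup (E H) e)
    ... | yes e∈H = from (T-∨ {not (lookup (E H) e)}) (inj₂ (from T-∧ (wfH e e∈H)))
    ... | no e∉H = from T-∨ (inj₁ (T-not⁺ e∉H))

  Joins : Fin (P n) → Fin n → Fin n → Set
  Joins e x y = (end₁ e ≡ x × end₂ e ≡ y) ⊎ (end₁ e ≡ y × end₂ e ≡ x)

  joins-ends : ∀ e → Joins e (end₁ e) (end₂ e)
  joins-ends e = inj₁ (refl , refl)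

  Joins-sym : ∀ {e x y} → Joins e x y → Joins e y x
  Joins-sym (inj₁ (p , q)) = inj₂ (p , q)
  Joins-sym (inj₂ (p , q)) = inj₁ (p , q)

  Joins-distinct : ∀ {e x y} → Joins e x y → x ≢ y
  Joins-distinct {e} (inj₁ (refl , refl)) = ends-distinct e
  Joins-distinct {e} (inj₂ (refl , refl)) eq = ends-distinct e (sym eq)

  Joins-avoids : ∀ {e x y v} → Joins e x y → x ≢ v → y ≢ v → end₁ e ≢ v × end₂ e ≢ v
  Joins-avoids (inj₁ (refl , refl)) x≢v y≢v = x≢v , y≢v
  Joins-avoids (inj₂ (refl , refl)) x≢v y≢v = y≢v , x≢v

  WellFormed-joins : ∀ {H} → WellFormed H → ∀ {e x y} → e ∈E H → Joins e x y → x ∈V H × y ∈V H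
  WellFormed-joins wfH e∈H (inj₁ (refl , refl)) = wfH _ e∈H
  WellFormed-joins wfH e∈H (inj₂ (refl , refl)) = proj₂ (wfH _ e∈H) , proj₁ (wfH _ e∈H)

  record LeavingEdge (K : SG n) (X : Vec Bool n) : Set where
    constructor leaving
    field
      {edge} : Fin (P n)
      {inner outer} : Fin n
      edge∈ : edge ∈E K
      joins : Joins edge inner outer
      inner∈ : inner ∈ₛ X
      outer∈ : outer ∈V K
      outer∉ : ¬ outer ∈ₛ X

  private
    leavesᵇ : SG n → Vec Bool n → Fin (P n) → Bool
    leavesᵇ K X e = lookup (E K) e ∧
      ((lookup X (end₁ e) ∧ lookup (V K) (end₂ e) ∧ not (lookup X (end₂ e))) ∨
       (lookup X (end₂ e) ∧ lookup (V K) (end₁ e) ∧ not (lookup X (end₁ e))))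

  LeavingEdge⇒crosses : ∀ {K X} → LeavingEdge K X → T (crosses K X)
  LeavingEdge⇒crosses {K} {X} (leaving {e} e∈K (inj₁ (refl , refl)) x∈X y∈K y∉X) =
    T-anyFin⁺ (leavesᵇ K X) e (from T-∧ (e∈K , from T-∨ (inj₁ (from T-∧ (x∈X , from T-∧ (y∈K , T-not⁺ y∉X))))))
  LeavingEdge⇒crosses {K} {X} (leaving {e} e∈K (inj₂ (refl , refl)) x∈X y∈K y∉X) =
    T-anyFin⁺ (leavesᵇ K X) e
      (from T-∧ (e∈K , from (T-∨ {lookup X (end₁ e) ∧ _}) (inj₂ (from T-∧ (x∈X , from T-∧ (y∈K , T-not⁺ y∉X))))))

  crosses⇒LeavingEdge : ∀ {K X} → T (crosses K X) → LeavingEdge K X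
  crosses⇒LeavingEdge {K} {X} t with T-anyFin⁻ (leavesᵇ K X) t
  ... | e , l with to T-∧ l
  ...   | e∈K , side with to (T-∨ {lookup X (end₁ e) ∧ _}) side
  ...     | inj₁ d = let x∈X , rest = to T-∧ d ; y∈K , y∉X = to T-∧ rest in
                     leaving e∈K (joins-ends e) x∈X y∈K (T-not⁻ y∉X)
  ...     | inj₂ d = let x∈X , rest = to T-∧ d ; y∈K , y∉X = to T-∧ rest in
                     leaving e∈K (Joins-sym (joins-ends e)) x∈X y∈K (T-not⁻ y∉X)

  ProperPart : SG n → Vec Bool n → Set
  ProperPart K X = X ⊆ₛ V K × (∃ λ x → x ∈ₛ X) × (∃ λ y → y ∈V K × ¬ y ∈ₛ X)

  Connected : SG n → Set
  Connected K = (∃ λ x → x ∈V K) × (∀ X → ProperPart K X → LeavingEdge K X)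

  private
    properᵇ : SG n → Vec Bool n → Bool
    properᵇ K X = (X ⊆ᵇ V K) ∧ nonemptyᵇ X ∧ not (V K ⊆ᵇ X)

    ProperPart⇒properᵇ : ∀ {K X} → ProperPart K X → T (properᵇ K X)
    ProperPart⇒properᵇ {K} {X} (X⊆K , (x , x∈X) , (y , y∈K , y∉X)) =
      from T-∧ (⊆ₛ⇒⊆ᵇ X (V K) X⊆K , from T-∧ (∃⇒nonemptyᵇ X x∈X , T-not⁺ (λ K⊆X → y∉X (⊆ᵇ⇒⊆ₛ (V K) X K⊆X y y∈K))))

    properᵇ⇒ProperPart : ∀ {K X} → T (properᵇ K X) → ProperPart K X
    properᵇ⇒ProperPart {K} {X} t =
      let X⊆K , rest = to T-∧ t ; ne , K⊈X = to (T-∧ {nonemptyᵇ X}) rest in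
      ⊆ᵇ⇒⊆ₛ X (V K) X⊆K , nonemptyᵇ⇒∃ X ne , ⊈ᵇ⇒witness (V K) X (T-not⁻ K⊈X)

  connected⇒Connected : ∀ {K} → T (connected K) → Connected K
  connected⇒Connected {K} t = nonemptyᵇ⇒∃ (V K) ne , λ X proper →
      crosses⇒LeavingEdge (cut X proper (to T-∨ (T-all⁻ _ cuts (∈-allSubsets X))))
    where
    ne : T (nonemptyᵇ (V K))
    ne = proj₁ (to T-∧ t)
    cuts : T (all (λ X → not (properᵇ K X) ∨ crosses K X) (allSubsets n))
    cuts = proj₂ (to (T-∧ {nonemptyᵇ (V K)}) t)
    cut : ∀ X → ProperPart K X → T (not (properᵇ K X)) ⊎ T (crosses K X) → T (crosses K X)
    cut X proper (inj₁ ¬proper) = ⊥-elim (T-not⁻ ¬proper (ProperPart⇒properᵇ {K} {X} proper))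
    cut X proper (inj₂ c) = c

  Connected⇒connected : ∀ {K} → Connected K → T (connected K)
  Connected⇒connected {K} ((x , x∈K) , leave) = from T-∧ (∃⇒nonemptyᵇ (V K) x∈K , T-all⁺ _ {allSubsets n} λ {X} _ → cut X)
    where
    cut : ∀ X → T (not (properᵇ K X) ∨ crosses K X)
    cut X with T? (properᵇ K X)
    ... | yes proper = from (T-∨ {not (properᵇ K X)}) (inj₂ (LeavingEdge⇒crosses (leave X (properᵇ⇒ProperPart {K} {X} proper))))
    ... | no ¬proper = from T-∨ (inj₁ (T-not⁺ ¬proper))

  data Walk (K : SG n) : Fin n → Fin n → Set where
    nil : ∀ {x} → x ∈V K → Walk K x x
    cons : ∀ {x y z} e → x ∈V K → e ∈E K → Joins e x y → Walk K y z → Walk K x z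

  module _ {K : SG n} where

    walk-start : ∀ {x y} → Walk K x y → x ∈V K
    walk-start (nil x∈K) = x∈K
    walk-start (cons _ x∈K _ _ _) = x∈K

    walk-end : ∀ {x y} → Walk K x y → y ∈V K
    walk-end (nil y∈K) = y∈K
    walk-end (cons _ _ _ _ p) = walk-end p

    _++ʷ_ : ∀ {x y z} → Walk K x y → Walk K y z → Walk K x z
    nil _ ++ʷ q = q
    cons e x∈K e∈K j p ++ʷ q = cons e x∈K e∈K j (p ++ʷ q)

    walk-snoc : ∀ {x y z} e → Walk K x y → e ∈E K → Joins e y z → z ∈V K → Walk K x z
    walk-snoc e p e∈K j z∈K = p ++ʷ cons e (walk-end p) e∈K j (nil z∈K)

    walk-reverse : ∀ {x y} → Walk K x y → Walk K y x
    walk-reverse (nil x∈K) = nil x∈K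
    walk-reverse (cons e x∈K e∈K j p) = walk-snoc e (walk-reverse p) e∈K (Joins-sym j) x∈K

    walk-leaves : ∀ {x z X} → Walk K x z → x ∈ₛ X → ¬ z ∈ₛ X → LeavingEdge K X
    walk-leaves (nil _) x∈X z∉X = ⊥-elim (z∉X x∈X)
    walk-leaves {X = X} (cons {y = y} e _ e∈K j p) x∈X z∉X with T? (lookup X y)
    ... | yes y∈X = walk-leaves p y∈X z∉X
    ... | no y∉X = leaving e∈K j x∈X (walk-start p) y∉X

  walk-mono : ∀ {K L} → K ⊑ L → ∀ {x y} → Walk K x y → Walk L x y
  walk-mono K⊑L (nil x∈K) = nil (proj₁ K⊑L _ x∈K)
  walk-mono K⊑L (cons e x∈K e∈K j p) = cons e (proj₁ K⊑L _ x∈K) (proj₂ K⊑L e e∈K) j (walk-mono K⊑L p)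

  walks⇒connected : ∀ {K} r → r ∈V K → (∀ y → y ∈V K → Walk K r y) → T (connected K)
  walks⇒connected {K} r r∈K walk = Connected⇒connected ((r , r∈K) , leave)
    where
    leave : ∀ X → ProperPart K X → LeavingEdge K X
    leave X (X⊆K , (x , x∈X) , (y , y∈K , y∉X)) with T? (lookup X r)
    ... | yes r∈X = walk-leaves (walk y y∈K) r∈X y∉X
    ... | no r∉X = walk-leaves (walk-reverse (walk x (X⊆K x x∈X))) x∈X r∉X

  connected⇒¬¬walk : ∀ {K} → T (connected K) → ∀ {x y} → x ∈V K → y ∈V K → ¬ ¬ Walk K x y
  connected⇒¬¬walk {K} c {x} {y} x∈K y∈K ¬walk = ¬¬-characteristic n (Walk K x) reach
    where
    reach : ¬ (Σ (Vec Bool n) λ R → ∀ i → i ∈ₛ R ⇔ Walk K x i)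
    reach (R , R⇔) with T? (lookup R y)
    ... | yes y∈R = ¬walk (to (R⇔ y) y∈R)
    ... | no y∉R with proj₂ (connected⇒Connected {K} c) R
                        ((λ i i∈R → walk-end (to (R⇔ i) i∈R)) , (x , from (R⇔ x) (nil x∈K)) , (y , y∈K , y∉R))
    ...   | leaving {e} {a} {b} e∈K j a∈R b∈K b∉R = b∉R (from (R⇔ b) (walk-snoc e (to (R⇔ a) a∈R) e∈K j b∈K))

  infixl 6 _∪ᴳ_ _∩ᴳ_

  _∪ᴳ_ : SG n → SG n → SG n
  H ∪ᴳ K = sg (V H ∪ V K) (E H ∪ E K)

  _∩ᴳ_ : SG n → SG n → SG n
  H ∩ᴳ K = sg (V H ∩ V K) (E H ∩ E K)

  ⊑-∪ᴳˡ : ∀ {H K} → H ⊑ H ∪ᴳ K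
  ⊑-∪ᴳˡ {H} {K} = ∈-∪⁺ˡ (V H) (V K) , ∈-∪⁺ˡ (E H) (E K)

  ⊑-∪ᴳʳ : ∀ {H K} → K ⊑ H ∪ᴳ K
  ⊑-∪ᴳʳ {H} {K} = ∈-∪⁺ʳ (V H) (V K) , ∈-∪⁺ʳ (E H) (E K)

  ∪ᴳ-least : ∀ {H K L} → H ⊑ L → K ⊑ L → H ∪ᴳ K ⊑ L
  ∪ᴳ-least {H} {K} (vH , eH) (vK , eK) =
    (λ i t → [ vH i , vK i ]′ (∈-∪⁻ (V H) (V K) i t)) , (λ i t → [ eH i , eK i ]′ (∈-∪⁻ (E H) (E K) i t))

  ∩ᴳ-⊑ʳ : ∀ {H K} → H ∩ᴳ K ⊑ K
  ∩ᴳ-⊑ʳ {H} {K} = (λ i t → proj₂ (∈-∩⁻ (V H) (V K) i t)) , (λ i t → proj₂ (∈-∩⁻ (E H) (E K) i t))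

  WellFormed-∪ᴳ : ∀ {H K} → WellFormed H → WellFormed K → WellFormed (H ∪ᴳ K)
  WellFormed-∪ᴳ {H} {K} wfH wfK e t with ∈-∪⁻ (E H) (E K) e t
  ... | inj₁ e∈H = ∈-∪⁺ˡ (V H) (V K) _ (proj₁ (wfH e e∈H)) , ∈-∪⁺ˡ (V H) (V K) _ (proj₂ (wfH e e∈H))
  ... | inj₂ e∈K = ∈-∪⁺ʳ (V H) (V K) _ (proj₁ (wfK e e∈K)) , ∈-∪⁺ʳ (V H) (V K) _ (proj₂ (wfK e e∈K))

  WellFormed-∩ᴳ : ∀ {H K} → WellFormed H → WellFormed K → WellFormed (H ∩ᴳ K)
  WellFormed-∩ᴳ {H} {K} wfH wfK e t =
    let e∈H , e∈K = ∈-∩⁻ (E H) (E K) e t in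
    ∈-∩⁺ (V H) (V K) _ (proj₁ (wfH e e∈H)) (proj₁ (wfK e e∈K)) , ∈-∩⁺ (V H) (V K) _ (proj₂ (wfH e e∈H)) (proj₂ (wfK e e∈K))

  leaving-through : ∀ {K L X} → T (connected K) → K ⊑ L →
                    (∃ λ a → a ∈V K × a ∈ₛ X) → (∃ λ b → b ∈V K × ¬ b ∈ₛ X) → LeavingEdge L X
  leaving-through {K} {L} {X} c (vK⊆L , eK⊆L) (a , a∈K , a∈X) (b , b∈K , b∉X)
    with proj₂ (connected⇒Connected {K} c) (X ∩ V K)
           ((λ i t → proj₂ (∈-∩⁻ X (V K) i t)) , (a , ∈-∩⁺ X (V K) a a∈X a∈K) , (b , b∈K , λ t → b∉X (proj₁ (∈-∩⁻ X (V K) b t))))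
  ... | leaving {e} {x} {y} e∈K j x∈X∩K y∈K y∉X∩K =
    leaving (eK⊆L e e∈K) j (proj₁ (∈-∩⁻ X (V K) x x∈X∩K)) (vK⊆L y y∈K) (λ y∈X → y∉X∩K (∈-∩⁺ X (V K) y y∈X y∈K))

  connected-∪ᴳ : ∀ {H K} v → T (connected H) → T (connected K) → v ∈V H → v ∈V K → T (connected (H ∪ᴳ K))
  connected-∪ᴳ {H} {K} v cH cK v∈H v∈K = Connected⇒connected ((v , ∈-∪⁺ˡ (V H) (V K) v v∈H) , leave)
    where
    leave : ∀ X → ProperPart (H ∪ᴳ K) X → LeavingEdge (H ∪ᴳ K) X
    leave X (X⊆H∪K , (x , x∈X) , (y , y∈H∪K , y∉X)) with T? (lookup X v)
    ... | yes v∈X = [ (λ y∈H → leaving-through {H} cH (⊑-∪ᴳˡ {H} {K}) (v , v∈H , v∈X) (y , y∈H , y∉X))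
                    , (λ y∈K → leaving-through {K} cK (⊑-∪ᴳʳ {H} {K}) (v , v∈K , v∈X) (y , y∈K , y∉X)) ]′
                    (∈-∪⁻ (V H) (V K) y y∈H∪K)
    ... | no v∉X = [ (λ x∈H → leaving-through {H} cH (⊑-∪ᴳˡ {H} {K}) (x , x∈H , x∈X) (v , v∈H , v∉X))
                   , (λ x∈K → leaving-through {K} cK (⊑-∪ᴳʳ {H} {K}) (x , x∈K , x∈X) (v , v∈K , v∉X)) ]′
                   (∈-∪⁻ (V H) (V K) x (X⊆H∪K x x∈X))

  connected-attach : ∀ {K L} → T (connected K) → K ⊑ L →
                     (∀ u → u ∈V L → u ∈V K ⊎ (∃ λ r → r ∈V K × Walk L u r)) → T (connected L)
  connected-attach {K} {L} c K⊑L attached with proj₁ (connected⇒Connected {K} c)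
  ... | k , k∈K = Connected⇒connected ((k , proj₁ K⊑L k k∈K) , leave)
    where
    leave : ∀ X → ProperPart L X → LeavingEdge L X
    leave X (X⊆L , (x , x∈X) , (y , y∈L , y∉X)) = inside (attached x (X⊆L x x∈X)) (outside (attached y y∈L))
      where
      outside : y ∈V K ⊎ (∃ λ r → r ∈V K × Walk L y r) → (∃ λ b → b ∈V K × ¬ b ∈ₛ X) ⊎ LeavingEdge L X
      outside (inj₁ y∈K) = inj₁ (y , y∈K , y∉X)
      outside (inj₂ (r , r∈K , p)) with T? (lookup X r)
      ... | yes r∈X = inj₂ (walk-leaves (walk-reverse p) r∈X y∉X)
      ... | no r∉X = inj₁ (r , r∈K , r∉X)
      inside : x ∈V K ⊎ (∃ λ r → r ∈V K × Walk L x r) → (∃ λ b → b ∈V K × ¬ b ∈ₛ X) ⊎ LeavingEdge L X → LeavingEdge L X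
      inside _ (inj₂ l) = l
      inside (inj₁ x∈K) (inj₁ b) = leaving-through {K} c K⊑L (x , x∈K , x∈X) b
      inside (inj₂ (r , r∈K , p)) (inj₁ b) with T? (lookup X r)
      ... | yes r∈X = leaving-through {K} c K⊑L (r , r∈K , r∈X) b
      ... | no r∉X = walk-leaves p x∈X r∉X

  -- For a part X containing w, a leaving edge is sought for X ∪ (V K ∩ V C) instead, so that it cannot lie in C.
  connected-∩ᴳ : ∀ {K A C} w → T (connected K) → (∀ e → e ∈E K → e ∈E A ⊎ e ∈E C) →
                 WellFormed A → WellFormed C → (∀ v → v ∈V A → v ∈V C → v ≡ w) →
                 w ∈V K → w ∈V A → T (connected (K ∩ᴳ A))
  connected-∩ᴳ {K} {A} {C} w c edges wfA wfC meet w∈K w∈A =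
    Connected⇒connected ((w , ∈-∩⁺ (V K) (V A) w w∈K w∈A) , leave)
    where
    inK : ∀ {v} → v ∈V K ∩ᴳ A → v ∈V K
    inK {v} t = proj₁ (∈-∩⁻ (V K) (V A) v t)
    inA : ∀ {v} → v ∈V K ∩ᴳ A → v ∈V A
    inA {v} t = proj₂ (∈-∩⁻ (V K) (V A) v t)
    in-∩ᴳ : ∀ {v} → v ∈V K → v ∈V A → v ∈V K ∩ᴳ A
    in-∩ᴳ {v} = ∈-∩⁺ (V K) (V A) v
    restrict : ∀ {X} → LeavingEdge K X → (∀ {e x y} → e ∈E C → Joins e x y → x ∈ₛ X → y ∈V K → y ∈ₛ X) →
               LeavingEdge (K ∩ᴳ A) X
    restrict (leaving {e} e∈K j x∈X y∈K y∉X) closedC with edges e e∈K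
    ... | inj₁ e∈A = leaving (∈-∩⁺ (E K) (E A) e e∈K e∈A) j x∈X (in-∩ᴳ y∈K (proj₂ (WellFormed-joins {A} wfA e∈A j))) y∉X
    ... | inj₂ e∈C = ⊥-elim (y∉X (closedC e∈C j x∈X y∈K))
    leave : ∀ X → ProperPart (K ∩ᴳ A) X → LeavingEdge (K ∩ᴳ A) X
    leave X (X⊆ , (x , x∈X) , (y , y∈ , y∉X)) with T? (lookup X w)
    ... | no w∉X = restrict (leaving-through {K} c (⊑-refl {K}) (x , inK (X⊆ x x∈X) , x∈X) (y , inK y∈ , y∉X)) closedC
      where
      closedC : ∀ {e a b} → e ∈E C → Joins e a b → a ∈ₛ X → b ∈V K → b ∈ₛ X
      closedC e∈C j a∈X _ =
        ⊥-elim (w∉X (subst (_∈ₛ X) (meet _ (inA (X⊆ _ a∈X)) (proj₁ (WellFormed-joins {C} wfC e∈C j))) a∈X))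
    ... | yes w∈X = unextend (restrict (leaving-through {K} c (⊑-refl {K}) (x , inK (X⊆ x x∈X) , ∈-∪⁺ˡ X _ x x∈X)
                                                                 (y , inK y∈ , y∉X′)) closedC)
      where
      X′ : Vec Bool n
      X′ = X ∪ (V K ∩ V C)
      in-X′ : ∀ {v} → v ∈ₛ X′ → v ∈ₛ X ⊎ (v ∈V K × v ∈V C)
      in-X′ {v} t = Data.Sum.map₂ (∈-∩⁻ (V K) (V C) v) (∈-∪⁻ X _ v t)
      y∉X′ : ¬ y ∈ₛ X′
      y∉X′ t = [ y∉X , (λ (_ , y∈C) → y∉X (subst (_∈ₛ X) (sym (meet y (inA y∈) y∈C)) w∈X)) ]′ (in-X′ t)
      closedC : ∀ {e a b} → e ∈E C → Joins e a b → a ∈ₛ X′ → b ∈V K → b ∈ₛ X′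
      closedC e∈C j _ b∈K = ∈-∪⁺ʳ X _ _ (∈-∩⁺ (V K) (V C) _ b∈K (proj₂ (WellFormed-joins {C} wfC e∈C j)))
      unextend : LeavingEdge (K ∩ᴳ A) X′ → LeavingEdge (K ∩ᴳ A) X
      unextend (leaving {e} e∈ j a∈X′ b∈ b∉X′) =
        leaving e∈ j ([ (λ a∈X → a∈X) , (λ (_ , a∈C) → subst (_∈ₛ X) (sym (meet _ a∈A a∈C)) w∈X) ]′ (in-X′ a∈X′))
                b∈ (λ b∈X → b∉X′ (∈-∪⁺ˡ X _ _ b∈X))
        where
        a∈A : _ ∈V A
        a∈A = proj₁ (WellFormed-joins {A} wfA (proj₂ (∈-∩⁻ (E K) (E A) e e∈)) j)

  module _ {K : SG n} where

    vertices : ∀ {x y} → Walk K x y → List (Fin n)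
    vertices (nil {x} _) = [ x ]
    vertices (cons {x} _ _ _ _ p) = x ∷ vertices p

    edges : ∀ {x y} → Walk K x y → List (Fin (P n))
    edges (nil _) = []
    edges (cons e _ _ _ p) = e ∷ edges p

    start∈vertices : ∀ {x y} (p : Walk K x y) → x ∈ vertices p
    start∈vertices (nil _) = here refl
    start∈vertices (cons _ _ _ _ _) = here refl

    end∈vertices : ∀ {x y} (p : Walk K x y) → y ∈ vertices p
    end∈vertices (nil _) = here refl
    end∈vertices (cons _ _ _ _ p) = there (end∈vertices p)

    vertices⊆V : ∀ {x y} (p : Walk K x y) {u} → u ∈ vertices p → u ∈V K
    vertices⊆V (nil x∈K) (here refl) = x∈K
    vertices⊆V (cons _ x∈K _ _ _) (here refl) = x∈K
    vertices⊆V (cons _ _ _ _ p) (there m) = vertices⊆V p m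

    edges⊆E : ∀ {x y} (p : Walk K x y) {e} → e ∈ edges p → e ∈E K
    edges⊆E (cons _ _ e∈K _ _) (here refl) = e∈K
    edges⊆E (cons _ _ _ _ p) (there m) = edges⊆E p m

    ends∈vertices : ∀ {x y} (p : Walk K x y) {e} → e ∈ edges p → end₁ e ∈ vertices p × end₂ e ∈ vertices p
    ends∈vertices (cons e _ _ (inj₁ (refl , refl)) p) (here refl) = here refl , there (start∈vertices p)
    ends∈vertices (cons e _ _ (inj₂ (refl , refl)) p) (here refl) = there (start∈vertices p) , here refl
    ends∈vertices (cons _ _ _ _ p) (there m) = Data.Product.map there there (ends∈vertices p m)

    edges-nonempty : ∀ {x y} → x ≢ y → (p : Walk K x y) → ∃ λ e → e ∈ edges p
    edges-nonempty x≢y (nil _) = ⊥-elim (x≢y refl)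
    edges-nonempty _ (cons e _ _ _ _) = e , here refl

    SimpleWalk : Fin n → Fin n → Set
    SimpleWalk x y = Σ (Walk K x y) λ p → Unique (vertices p)

    walk-suffix : ∀ {x y z} (p : Walk K y z) → x ∈ vertices p → Unique (vertices p) →
                  Σ (SimpleWalk x z) λ q → vertices (proj₁ q) ⊆ vertices p
    walk-suffix p@(nil _) (here refl) u = (p , u) , (λ m → m)
    walk-suffix p@(cons _ _ _ _ _) (here refl) u = (p , u) , (λ m → m)
    walk-suffix (cons _ _ _ _ p) (there m) (_ ∷ u) with walk-suffix p m u
    ... | q , q⊆p = q , (λ m′ → there (q⊆p m′))

    walk-simplify : ∀ {x y} → Walk K x y → SimpleWalk x y
    walk-simplify (nil x∈K) = nil x∈K , [] ∷ []
    walk-simplify (cons {x} e x∈K e∈K j p) with walk-simplify p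
    ... | q , u with DecMembership._∈?_ _≟_ x (vertices q)
    ...   | yes x∈q = proj₁ (walk-suffix q x∈q u)
    ...   | no x∉q = cons e x∈K e∈K j q , ¬Any⇒All¬ (vertices q) x∉q ∷ u

  walk-transfer : ∀ {K x y} (L : SG n) (p : Walk K x y) →
                  (∀ {u} → u ∈ vertices p → u ∈V L) → (∀ {e} → e ∈ edges p → e ∈E L) →
                  Σ (Walk L x y) λ q → vertices q ≡ vertices p
  walk-transfer L (nil _) inV _ = nil (inV (here refl)) , refl
  walk-transfer L (cons e _ _ j p) inV inE with walk-transfer L p (inV ∘ there) (inE ∘ there)
  ... | q , eq = cons e (inV (here refl)) (inE (here refl)) j q , cong (_ ∷_) eq

  module _ (H : SG n) (v : Fin n) where

    ∈V-deleteVertex⁻ : ∀ u → u ∈V deleteVertex H v → u ∈V H × u ≢ v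
    ∈V-deleteVertex⁻ u t = let u∈H , u≠v = to T-∧ (∈-tabulate⁻ _ u t) in u∈H , λ eq → T-not⁻ u≠v (fromWitness eq)

    ∈V-deleteVertex⁺ : ∀ u → u ∈V H → u ≢ v → u ∈V deleteVertex H v
    ∈V-deleteVertex⁺ u u∈H u≢v = ∈-tabulate⁺ (λ u → lookup (V H) u ∧ not ⌊ u ≟ v ⌋) u
                                   (from T-∧ (u∈H , T-not⁺ (u≢v ∘ toWitness)))

    ∈E-deleteVertex⁻ : ∀ e → e ∈E deleteVertex H v → e ∈E H × end₁ e ≢ v × end₂ e ≢ v
    ∈E-deleteVertex⁻ e t =
      let e∈H , rest = to T-∧ (∈-tabulate⁻ _ e t) ; ≠₁ , ≠₂ = to (T-∧ {not ⌊ end₁ e ≟ v ⌋}) rest in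
      e∈H , (λ eq → T-not⁻ ≠₁ (fromWitness eq)) , (λ eq → T-not⁻ ≠₂ (fromWitness eq))

    ∈E-deleteVertex⁺ : ∀ e → e ∈E H → end₁ e ≢ v → end₂ e ≢ v → e ∈E deleteVertex H v
    ∈E-deleteVertex⁺ e e∈H ≢₁ ≢₂ =
      ∈-tabulate⁺ (λ e → lookup (E H) e ∧ not ⌊ end₁ e ≟ v ⌋ ∧ not ⌊ end₂ e ≟ v ⌋) e
        (from T-∧ (e∈H , from T-∧ (T-not⁺ {⌊ end₁ e ≟ v ⌋} (≢₁ ∘ toWitness) , T-not⁺ {⌊ end₂ e ≟ v ⌋} (≢₂ ∘ toWitness))))

    deleteVertex-⊑ : deleteVertex H v ⊑ H
    deleteVertex-⊑ = (λ u t → proj₁ (∈V-deleteVertex⁻ u t)) , (λ e t → proj₁ (∈E-deleteVertex⁻ e t))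

    walk-avoiding : ∀ {x y} (p : Walk H x y) → ¬ v ∈ vertices p → Walk (deleteVertex H v) x y
    walk-avoiding (nil {x} x∈H) v∉p = nil (∈V-deleteVertex⁺ x x∈H (λ eq → v∉p (here (sym eq))))
    walk-avoiding (cons {x} {y} e x∈H e∈H j p) v∉p =
      cons e (∈V-deleteVertex⁺ x x∈H x≢v) (∈E-deleteVertex⁺ e e∈H ≢₁ ≢₂) j (walk-avoiding p (v∉p ∘ there))
      where
      x≢v : x ≢ v
      x≢v eq = v∉p (here (sym eq))
      y≢v : y ≢ v
      y≢v eq = v∉p (there (subst (_∈ vertices p) eq (start∈vertices p)))
      ≢₁ : end₁ e ≢ v
      ≢₁ = proj₁ (Joins-avoids j x≢v y≢v)
      ≢₂ : end₂ e ≢ v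
      ≢₂ = proj₂ (Joins-avoids j x≢v y≢v)

    simple-walk-escape : ∀ {a c} (p : Walk H a c) → Unique (vertices p) → ∀ {u} → u ∈ vertices p → u ≢ v →
                         (a ≢ v × Walk (deleteVertex H v) u a) ⊎ (c ≢ v × Walk (deleteVertex H v) u c)
    simple-walk-escape (nil a∈H) _ (here refl) u≢v = inj₁ (u≢v , nil (∈V-deleteVertex⁺ _ a∈H u≢v))
    simple-walk-escape (cons _ a∈H _ _ _) _ (here refl) u≢v = inj₁ (u≢v , nil (∈V-deleteVertex⁺ _ a∈H u≢v))
    simple-walk-escape (cons {a} e a∈H e∈H j p) (a∉p ∷ unique) (there m) u≢v
      with simple-walk-escape p unique m u≢v
    ... | inj₂ to-c = inj₂ to-c
    ... | inj₁ (y≢v , to-y) with a ≟ v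
    ...   | no a≢v = inj₁ (a≢v , walk-snoc e to-y (∈E-deleteVertex⁺ e e∈H ≢₁ ≢₂) (Joins-sym j)
                                   (∈V-deleteVertex⁺ a a∈H a≢v))
      where
      ≢₁ : end₁ e ≢ v
      ≢₁ = proj₁ (Joins-avoids j a≢v y≢v)
      ≢₂ : end₂ e ≢ v
      ≢₂ = proj₂ (Joins-avoids j a≢v y≢v)
    ...   | yes refl with walk-suffix p m unique
    ...     | (q , _) , q⊆p = inj₂ ((λ eq → v∉q (subst (_∈ vertices q) eq (end∈vertices q))) , walk-avoiding q v∉q)
      where
      v∉q : ¬ v ∈ vertices q
      v∉q = All¬⇒¬Any a∉p ∘ q⊆p

  deleteVertex-∉ : ∀ {H : SG n} {v} → WellFormed H → ¬ v ∈V H → deleteVertex H v ≡ H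
  deleteVertex-∉ {H} {v} wfH v∉H = ⊑-antisym {deleteVertex H v} {H} (deleteVertex-⊑ H v)
    ((λ u u∈H → ∈V-deleteVertex⁺ H v u u∈H (λ { refl → v∉H u∈H })) ,
     (λ e e∈H → ∈E-deleteVertex⁺ H v e e∈H (λ { refl → v∉H (proj₁ (wfH e e∈H)) }) (λ { refl → v∉H (proj₂ (wfH e e∈H)) })))

  ∩ᴳ-∪ᴳ-distrib-cover : ∀ {K A C} → K ⊑ A ∪ᴳ C → (K ∩ᴳ A) ∪ᴳ (K ∩ᴳ C) ≡ K
  ∩ᴳ-∪ᴳ-distrib-cover (vK , eK) = graph-ext (∩-∪-distrib-cover vK) (∩-∪-distrib-cover eK)

  ∪ᴳ-∩ᴳ-absorbˡ : ∀ {K₁ K₂ A} → K₁ ⊑ A →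
                  (∀ v → v ∈V K₂ → v ∈V A → v ∈V K₁) → (∀ e → e ∈E K₂ → e ∈E A → e ∈E K₁) → (K₁ ∪ᴳ K₂) ∩ᴳ A ≡ K₁
  ∪ᴳ-∩ᴳ-absorbˡ (vK₁ , eK₁) vK₂ eK₂ = graph-ext (∪-∩-absorbˡ vK₁ vK₂) (∪-∩-absorbˡ eK₁ eK₂)

  ∪ᴳ-∩ᴳ-absorbʳ : ∀ {K₁ K₂ A} → K₂ ⊑ A →
                  (∀ v → v ∈V K₁ → v ∈V A → v ∈V K₂) → (∀ e → e ∈E K₁ → e ∈E A → e ∈E K₂) → (K₁ ∪ᴳ K₂) ∩ᴳ A ≡ K₂
  ∪ᴳ-∩ᴳ-absorbʳ (vK₂ , eK₂) vK₁ eK₁ = graph-ext (∪-∩-absorbʳ vK₂ vK₁) (∪-∩-absorbʳ eK₂ eK₁)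

  point : Fin n → SG n
  point w = sg (singletonV w) (replicate (P n) false)

  point-WellFormed : ∀ w → WellFormed (point w)
  point-WellFormed w e e∈ = ⊥-elim (∉-empty e e∈)

  point-connected : ∀ w → T (connected (point w))
  point-connected w = walks⇒connected w (∈-singletonV⁺ w)
    (λ y y∈ → subst (Walk (point w) w) (sym (∈-singletonV⁻ w y y∈)) (nil (∈-singletonV⁺ w)))

  point-⊑ : ∀ {w H} → w ∈V H → point w ⊑ H
  point-⊑ {w} {H} w∈H = (λ v v∈ → subst (_∈V H) (sym (∈-singletonV⁻ w v v∈)) w∈H) , (λ e e∈ → ⊥-elim (∉-empty e e∈))

  ⊑-point : ∀ {w H} → w ∈V H → (∀ v → v ∈V H → v ≡ w) → (∀ e → ¬ e ∈E H) → H ≡ point w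
  ⊑-point {w} {H} w∈H only-w no-edges = ⊑-antisym
    ((λ v v∈H → subst (_∈ₛ singletonV w) (sym (only-w v v∈H)) (∈-singletonV⁺ w)) , (λ e e∈H → ⊥-elim (no-edges e e∈H)))
    (point-⊑ {w} {H} w∈H)

  edgeGraph : Fin (P n) → SG n
  edgeGraph f = sg (singletonV (end₁ f) ∪ singletonV (end₂ f)) (singletonV f)

  module _ (f : Fin (P n)) where

    ∈E-edgeGraph⁻ : ∀ e → e ∈E edgeGraph f → e ≡ f
    ∈E-edgeGraph⁻ e = ∈-singletonV⁻ f e

    ∈V-edgeGraph⁻ : ∀ u → u ∈V edgeGraph f → u ≡ end₁ f ⊎ u ≡ end₂ f
    ∈V-edgeGraph⁻ u t = Data.Sum.map (∈-singletonV⁻ (end₁ f) u) (∈-singletonV⁻ (end₂ f) u)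
                                     (∈-∪⁻ (singletonV (end₁ f)) (singletonV (end₂ f)) u t)

    end₁∈edgeGraph : end₁ f ∈V edgeGraph f
    end₁∈edgeGraph = ∈-∪⁺ˡ (singletonV (end₁ f)) (singletonV (end₂ f)) (end₁ f) (∈-singletonV⁺ (end₁ f))

    end₂∈edgeGraph : end₂ f ∈V edgeGraph f
    end₂∈edgeGraph = ∈-∪⁺ʳ (singletonV (end₁ f)) (singletonV (end₂ f)) (end₂ f) (∈-singletonV⁺ (end₂ f))

    joins∈edgeGraph : ∀ {x y} → Joins f x y → x ∈V edgeGraph f × y ∈V edgeGraph f
    joins∈edgeGraph (inj₁ (refl , refl)) = end₁∈edgeGraph , end₂∈edgeGraph
    joins∈edgeGraph (inj₂ (refl , refl)) = end₂∈edgeGraph , end₁∈edgeGraph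

    edgeGraph-WellFormed : WellFormed (edgeGraph f)
    edgeGraph-WellFormed e e∈ with ∈E-edgeGraph⁻ e e∈
    ... | refl = end₁∈edgeGraph , end₂∈edgeGraph

    edgeGraph-connected : T (connected (edgeGraph f))
    edgeGraph-connected = walks⇒connected (end₁ f) end₁∈edgeGraph walk
      where
      walk : ∀ y → y ∈V edgeGraph f → Walk (edgeGraph f) (end₁ f) y
      walk y y∈ with ∈V-edgeGraph⁻ y y∈
      ... | inj₁ refl = nil end₁∈edgeGraph
      ... | inj₂ refl = cons f end₁∈edgeGraph (∈-singletonV⁺ f) (joins-ends f) (nil end₂∈edgeGraph)

    edgeGraph-⊑ : ∀ {H} → WellFormed H → f ∈E H → edgeGraph f ⊑ H
    edgeGraph-⊑ {H} wfH f∈H =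
      (λ u u∈ → [ (λ { refl → proj₁ (wfH f f∈H) }) , (λ { refl → proj₂ (wfH f f∈H) }) ]′ (∈V-edgeGraph⁻ u u∈)) ,
      (λ e e∈ → subst (_∈E H) (sym (∈E-edgeGraph⁻ e e∈)) f∈H)

-- Counting connected subgraphs

module _ {A : Set} where

  countᵇ-++ : ∀ (p : A → Bool) xs ys → countᵇ p (xs ++ ys) ≡ countᵇ p xs + countᵇ p ys
  countᵇ-++ p [] ys = refl
  countᵇ-++ p (x ∷ xs) ys with p x
  ... | true = cong suc (countᵇ-++ p xs ys)
  ... | false = countᵇ-++ p xs ys

  countᵇ-≗ : ∀ {p q : A → Bool} → (∀ x → T (p x) → T (q x)) → (∀ x → T (q x) → T (p x)) → ∀ xs → countᵇ p xs ≡ countᵇ q xs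
  countᵇ-≗ {p} {q} p⇒q q⇒p [] = refl
  countᵇ-≗ {p} {q} p⇒q q⇒p (x ∷ xs) with p x | q x | T-ext {p x} {q x} (p⇒q x) (q⇒p x)
  ... | true | true | _ = cong suc (countᵇ-≗ p⇒q q⇒p xs)
  ... | false | false | _ = countᵇ-≗ p⇒q q⇒p xs

  countᵇ-none : ∀ {p : A → Bool} → (∀ x → ¬ T (p x)) → ∀ xs → countᵇ p xs ≡ 0
  countᵇ-none {p} none [] = refl
  countᵇ-none {p} none (x ∷ xs) with p x | none x
  ... | true | ¬px = ⊥-elim (¬px tt)
  ... | false | _ = countᵇ-none none xs

  countᵇ-positive : ∀ (p : A → Bool) {x xs} → x ∈ xs → T (p x) → 1 ≤ countᵇ p xs
  countᵇ-positive p {xs = y ∷ ys} (here refl) px with p y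
  ... | true = s≤s z≤n
  countᵇ-positive p {xs = y ∷ ys} (there m) px with p y
  ... | true = s≤s z≤n
  ... | false = countᵇ-positive p m px

  countᵇ-mono : ∀ {p q : A → Bool} → (∀ x → T (p x) → T (q x)) → ∀ xs → countᵇ p xs ≤ countᵇ q xs
  countᵇ-mono {p} {q} p⇒q [] = z≤n
  countᵇ-mono {p} {q} p⇒q (x ∷ xs) with p x | q x | p⇒q x
  ... | true | true | _ = s≤s (countᵇ-mono p⇒q xs)
  ... | true | false | p⇒q′ = ⊥-elim (p⇒q′ tt)
  ... | false | true | _ = m≤n⇒m≤1+n (countᵇ-mono p⇒q xs)
  ... | false | false | _ = countᵇ-mono p⇒q xs

  countᵇ-split : ∀ (p q : A → Bool) xs → countᵇ p xs ≡ countᵇ (λ x → p x ∧ q x) xs + countᵇ (λ x → p x ∧ not (q x)) xs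
  countᵇ-split p q [] = refl
  countᵇ-split p q (x ∷ xs) with p x | q x
  ... | true | true = cong suc (countᵇ-split p q xs)
  ... | true | false = trans (cong suc (countᵇ-split p q xs)) (sym (+-suc _ _))
  ... | false | _ = countᵇ-split p q xs

  countᵇ-map : ∀ {B : Set} {p : A → Bool} (f : B → A) xs → countᵇ p (map f xs) ≡ countᵇ (p ∘ f) xs
  countᵇ-map {p = p} f [] = refl
  countᵇ-map {p = p} f (x ∷ xs) with p (f x)
  ... | true = cong suc (countᵇ-map f xs)
  ... | false = countᵇ-map f xs

  Unique-⊆⇒length-≤ : ∀ {xs ys : List A} → Unique xs → xs ⊆ ys → length xs ≤ length ys
  Unique-⊆⇒length-≤ {[]} _ _ = z≤n
  Unique-⊆⇒length-≤ {x ∷ xs} (x∉xs ∷ unique) x∷xs⊆ys with ∈-∃++ (x∷xs⊆ys (here refl))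
  ... | ys₁ , ys₂ , refl = subst (suc (length xs) ≤_) (sym length-split) (s≤s (Unique-⊆⇒length-≤ unique xs⊆rest))
    where
    length-split : length (ys₁ ++ [ x ] ++ ys₂) ≡ suc (length (ys₁ ++ ys₂))
    length-split = trans (length-++ ys₁) (trans (+-suc (length ys₁) (length ys₂)) (cong suc (sym (length-++ ys₁))))
    xs⊆rest : xs ⊆ ys₁ ++ ys₂
    xs⊆rest {y} y∈xs with ∈-++⁻ ys₁ (x∷xs⊆ys (there y∈xs))
    ... | inj₁ y∈ys₁ = ∈-++⁺ˡ y∈ys₁
    ... | inj₂ (here refl) = ⊥-elim (All¬⇒¬Any x∉xs y∈xs)
    ... | inj₂ (there y∈ys₂) = ∈-++⁺ʳ ys₁ y∈ys₂

record Enumeration (A : Set) : Set where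
  field
    elements : List A
    unique : Unique elements
    complete : ∀ a → a ∈ elements
open Enumeration public

countᵇ-injection : ∀ {A B : Set} (EA : Enumeration A) (EB : Enumeration B) {p : A → Bool} {q : B → Bool}
                   (f : A → B) → (∀ a → T (p a) → T (q (f a))) →
                   (∀ a a′ → T (p a) → T (p a′) → f a ≡ f a′ → a ≡ a′) →
                   countᵇ p (elements EA) ≤ countᵇ q (elements EB)
countᵇ-injection EA EB {p} {q} f pq inj =
  subst (_≤ countᵇ q (elements EB)) (length-map f (filterᵇ p (elements EA)))
    (Unique-⊆⇒length-≤ (unique-image (elements EA) (unique EA)) image⊆)
  where
  unique-image : ∀ xs → Unique xs → Unique (map f (filterᵇ p xs))
  unique-image [] _ = []
  unique-image (x ∷ xs) (x∉xs ∷ u) with p x in px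
  ... | false = unique-image xs u
  ... | true = fresh xs x∉xs ∷ unique-image xs u
    where
    fresh : ∀ ys → All (x ≢_) ys → All (f x ≢_) (map f (filterᵇ p ys))
    fresh [] _ = []
    fresh (y ∷ ys) (x≢y ∷ x∉ys) with p y in py
    ... | false = fresh ys x∉ys
    ... | true = (λ fx≡fy → x≢y (inj x y (from T-≡ px) (from T-≡ py) fx≡fy)) ∷ fresh ys x∉ys
  image⊆ : map f (filterᵇ p (elements EA)) ⊆ filterᵇ q (elements EB)
  image⊆ m with ∈-map⁻ f m
  ... | a , a∈ , refl = ∈-filter⁺ (T? ∘ q) (complete EB (f a)) (pq a (proj₂ (∈-filter⁻ (T? ∘ p) {xs = elements EA} a∈)))

countᵇ-bijection : ∀ {A B : Set} (EA : Enumeration A) (EB : Enumeration B) {p : A → Bool} {q : B → Bool}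
                   (f : A → B) (g : B → A) → (∀ a → T (p a) → T (q (f a))) → (∀ b → T (q b) → T (p (g b))) →
                   (∀ a → T (p a) → g (f a) ≡ a) → (∀ b → T (q b) → f (g b) ≡ b) →
                   countᵇ p (elements EA) ≡ countᵇ q (elements EB)
countᵇ-bijection EA EB f g pq qp gf fg = ≤-antisym
  (countᵇ-injection EA EB f pq (λ a a′ pa pa′ eq → trans (sym (gf a pa)) (trans (cong g eq) (gf a′ pa′))))
  (countᵇ-injection EB EA g qp (λ b b′ qb qb′ eq → trans (sym (fg b qb)) (trans (cong f eq) (fg b′ qb′))))

Unique-allSubsets : ∀ m → Unique (allSubsets m)
Unique-allSubsets zero = [] ∷ []
Unique-allSubsets (suc m) = Unique-concatMap (allSubsets m) (Unique-allSubsets m)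
  where
  extensions : Vec Bool m → List (Vec Bool (suc m))
  extensions X = (true ∷ X) ∷ (false ∷ X) ∷ []
  tail-of : ∀ {X Y b} → (b ∷ X) ∈ extensions Y → X ≡ Y
  tail-of (here refl) = refl
  tail-of (there (here refl)) = refl
  Unique-concatMap : ∀ xs → Unique xs → Unique (concatMap extensions xs)
  Unique-concatMap [] _ = []
  Unique-concatMap (X ∷ xs) (X∉xs ∷ u) = Unique.++⁺ (((λ ()) ∷ []) ∷ [] ∷ []) (Unique-concatMap xs u) disjoint
    where
    disjoint : ∀ {Z} → Z ∈ extensions X × Z ∈ concatMap extensions xs → ⊥
    disjoint {b ∷ Z} (Z∈X , Z∈xs) = go xs X∉xs Z∈xs
      where
      go : ∀ ys → All (X ≢_) ys → (b ∷ Z) ∈ concatMap extensions ys → ⊥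
      go (Y ∷ ys) (X≢Y ∷ X∉ys) m with ∈-++⁻ (extensions Y) m
      ... | inj₁ Z∈Y = X≢Y (trans (sym (tail-of Z∈X)) (tail-of Z∈Y))
      ... | inj₂ Z∈ys = go ys X∉ys Z∈ys

subsets : ∀ m → Enumeration (Vec Bool m)
subsets m = record { elements = allSubsets m ; unique = Unique-allSubsets m ; complete = ∈-allSubsets }

_×ᴱ_ : ∀ {A B : Set} → Enumeration A → Enumeration B → Enumeration (A × B)
EA ×ᴱ EB = record
  { elements = cartesianProduct (elements EA) (elements EB)
  ; unique = Unique.cartesianProduct⁺ (unique EA) (unique EB)
  ; complete = λ (a , b) → ∈-cartesianProduct⁺ (complete EA a) (complete EB b) }

unit : Enumeration ⊤
unit = record { elements = tt ∷ [] ; unique = [] ∷ [] ; complete = λ { tt → here refl } }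

graphs : ∀ n → Enumeration (SG n)
graphs n = record
  { elements = map toGraph (elements vertex-and-edge-sets)
  ; unique = Unique.map⁺ (λ eq → cong₂ _,_ (cong V eq) (cong E eq)) (unique vertex-and-edge-sets)
  ; complete = λ K → ∈-map⁺ toGraph (complete vertex-and-edge-sets (V K , E K)) }
  where
  vertex-and-edge-sets : Enumeration (Vec Bool n × Vec Bool (P n))
  vertex-and-edge-sets = subsets n ×ᴱ subsets (P n)
  toGraph : Vec Bool n × Vec Bool (P n) → SG n
  toGraph (X , Y) = sg X Y

countᵇ-cartesianProduct : ∀ {A B : Set} (p : A → Bool) (q : B → Bool) xs ys →
  countᵇ (λ (a , b) → p a ∧ q b) (cartesianProduct xs ys) ≡ countᵇ p xs * countᵇ q ys
countᵇ-cartesianProduct p q [] ys = refl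
countᵇ-cartesianProduct p q (x ∷ xs) ys =
  trans (countᵇ-++ _ (map (x ,_) ys) (cartesianProduct xs ys))
        (trans (cong₂ _+_ (countᵇ-map (x ,_) ys) (countᵇ-cartesianProduct p q xs ys)) row)
  where
  row : countᵇ (λ y → p x ∧ q y) ys + countᵇ p xs * countᵇ q ys ≡ countᵇ p (x ∷ xs) * countᵇ q ys
  row with p x
  ... | true = refl
  ... | false = cong (_+ countᵇ p xs * countᵇ q ys) (countᵇ-none (λ _ ()) ys)

countᵇ-cartesianProduct-rows : ∀ {A B : Set} (r : A × B → Bool) xs ys →
  countᵇ r (cartesianProduct xs ys) ≡ sum (map (λ x → countᵇ (λ y → r (x , y)) ys) xs)
countᵇ-cartesianProduct-rows r [] ys = refl
countᵇ-cartesianProduct-rows r (x ∷ xs) ys = trans (countᵇ-++ r (map (x ,_) ys) (cartesianProduct xs ys))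
  (cong₂ _+_ (countᵇ-map (x ,_) ys) (countᵇ-cartesianProduct-rows r xs ys))

module _ {n : ℕ} where

  countGraphs : (SG n → Bool) → ℕ
  countGraphs p = countᵇ p (elements (graphs n))

  isConnectedSubgraph : SG n → List (Fin n) → SG n → Bool
  isConnectedSubgraph H ws K = wf K ∧ (K ≼ H) ∧ connected K ∧ all (lookup (V K)) ws

  fc≡countGraphs : ∀ H ws → fc H ws ≡ countGraphs (isConnectedSubgraph H ws)
  fc≡countGraphs H ws = sym (trans (countᵇ-map _ (cartesianProduct (allSubsets n) (allSubsets (P n))))
                                   (countᵇ-cartesianProduct-rows _ (allSubsets n) (allSubsets (P n))))

  record ConnectedSubgraph (H : SG n) (ws : List (Fin n)) (K : SG n) : Set where
    constructor connectedSubgraph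
    field
      wellFormed : WellFormed K
      ⊑host : K ⊑ H
      conn : T (connected K)
      through : ∀ {v} → v ∈ ws → v ∈V K
  open ConnectedSubgraph public

  isConnectedSubgraph⇒ : ∀ {H ws K} → T (isConnectedSubgraph H ws K) → ConnectedSubgraph H ws K
  isConnectedSubgraph⇒ {H} {ws} {K} t =
    let wfK , t₁ = to T-∧ t ; K≼H , t₂ = to (T-∧ {K ≼ H}) t₁ ; cK , wsK = to (T-∧ {connected K}) t₂ in
    connectedSubgraph (wf⇒WellFormed {H = K} wfK) (≼⇒⊑ {H = K} {H} K≼H) cK (T-all⁻ (lookup (V K)) wsK)

  ⇒isConnectedSubgraph : ∀ {H ws K} → ConnectedSubgraph H ws K → T (isConnectedSubgraph H ws K)
  ⇒isConnectedSubgraph {H} {ws} {K} (connectedSubgraph wfK K⊑H cK wsK) =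
    from T-∧ (WellFormed⇒wf {H = K} wfK , from T-∧ (⊑⇒≼ {H = K} {H} K⊑H , from T-∧ (cK , T-all⁺ (lookup (V K)) wsK)))

  fc-positive : ∀ {H v} → v ∈V H → 1 ≤ fc H [ v ]
  fc-positive {H} {v} v∈H = subst (1 ≤_) (sym (fc≡countGraphs H [ v ]))
    (countᵇ-positive (isConnectedSubgraph H [ v ]) (complete (graphs n) (point v))
      (⇒isConnectedSubgraph {H} {[ v ]} {point v} (connectedSubgraph (point-WellFormed v) (point-⊑ {w = v} {H} v∈H) (point-connected v)
                                                 (λ { (here refl) → ∈-singletonV⁺ v ; (there ()) }))))

  fc≤Fc : ∀ H ws → fc H ws ≤ Fc H
  fc≤Fc H ws = subst₂ _≤_ (sym (fc≡countGraphs H ws)) (sym (fc≡countGraphs H []))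
    (countᵇ-mono {p = isConnectedSubgraph H ws} {isConnectedSubgraph H []} forget-ws (elements (graphs n)))
    where
    forget-ws : ∀ K → T (isConnectedSubgraph H ws K) → T (isConnectedSubgraph H [] K)
    forget-ws K t = let cs = isConnectedSubgraph⇒ {H} {ws} {K} t in
                    ⇒isConnectedSubgraph {H} {[]} {K} (connectedSubgraph (wellFormed cs) (⊑host cs) (conn cs) λ ())

  Fc≡fc+avoiding : ∀ H v → Fc H ≡ fc H [ v ] + countGraphs (λ K → isConnectedSubgraph H [] K ∧ not (lookup (V K) v))
  Fc≡fc+avoiding H v = begin
    Fc H                                                                ≡⟨ fc≡countGraphs H [] ⟩
    countGraphs (isConnectedSubgraph H [])                              ≡⟨ countᵇ-split _ (λ K → lookup (V K) v) (elements (graphs n)) ⟩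
    countGraphs (λ K → isConnectedSubgraph H [] K ∧ lookup (V K) v) + avoiding
      ≡⟨ cong (_+ avoiding) (countᵇ-≗ through-v⇒ ⇒through-v (elements (graphs n))) ⟩
    countGraphs (isConnectedSubgraph H [ v ]) + avoiding                ≡⟨ cong (_+ avoiding) (sym (fc≡countGraphs H [ v ])) ⟩
    fc H [ v ] + avoiding                                               ∎
    where
    avoiding : ℕ
    avoiding = countGraphs (λ K → isConnectedSubgraph H [] K ∧ not (lookup (V K) v))
    through-v⇒ : ∀ K → T (isConnectedSubgraph H [] K ∧ lookup (V K) v) → T (isConnectedSubgraph H [ v ] K)
    through-v⇒ K t = let cs , v∈K = to T-∧ t ; c = isConnectedSubgraph⇒ {H} {[]} {K} cs in
      ⇒isConnectedSubgraph {H} {[ v ]} {K} (connectedSubgraph (wellFormed c) (⊑host c) (conn c) λ { (here refl) → v∈K ; (there ()) })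
    ⇒through-v : ∀ K → T (isConnectedSubgraph H [ v ] K) → T (isConnectedSubgraph H [] K ∧ lookup (V K) v)
    ⇒through-v K t = let c = isConnectedSubgraph⇒ {H} {[ v ]} {K} t in
      from T-∧ (⇒isConnectedSubgraph {H} {[]} {K} (connectedSubgraph (wellFormed c) (⊑host c) (conn c) λ ()) , through c (here refl))

-- Gluing two graphs at a vertex

module Gluing {n : ℕ} (A C : SG n) (w : Fin n) (wfA : WellFormed A) (wfC : WellFormed C)
  (w∈A : w ∈V A) (w∈C : w ∈V C) (meet : ∀ v → v ∈V A → v ∈V C → v ≡ w) (edge-disjoint : ∀ e → e ∈E A → e ∈E C → ⊥) where

  G : SG n
  G = A ∪ᴳ C

  private
    CS : SG n → List (Fin n) → SG n → Bool
    CS = isConnectedSubgraph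

    vertex-side : ∀ {K} → K ⊑ G → ∀ v → v ∈V K → v ∈V A ⊎ v ∈V C
    vertex-side K⊑G v t = ∈-∪⁻ (V A) (V C) v (proj₁ K⊑G v t)

    edge-side : ∀ {K} → K ⊑ G → ∀ e → e ∈E K → e ∈E A ⊎ e ∈E C
    edge-side K⊑G e t = ∈-∪⁻ (E A) (E C) e (proj₂ K⊑G e t)

    meet′ : ∀ v → v ∈V C → v ∈V A → v ≡ w
    meet′ v v∈C v∈A = meet v v∈A v∈C

  misses-A : ∀ {K} → WellFormed K → T (connected K) → K ⊑ G → ¬ T (K ≼ A) → ¬ w ∈V K → ∀ v → v ∈V K → ¬ v ∈V A
  misses-A {K} wfK cK K⊑G K⋢A w∉K v v∈K v∈A =
    no-leaving (proj₂ (connected⇒Connected {K = K} cK) X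
                  ((λ i t → proj₁ (∈-∩⁻ (V K) (V A) i t)) , (v , ∈-∩⁺ (V K) (V A) v v∈K v∈A) , outside))
    where
    X : Vec Bool n
    X = V K ∩ V A
    outside : ∃ λ y → y ∈V K × ¬ y ∈ₛ X
    outside with ⋢⇒witness {H = K} {A} K⋢A
    ... | inj₁ (y , y∈K , y∉A) = y , y∈K , (y∉A ∘ proj₂ ∘ ∈-∩⁻ (V K) (V A) y)
    ... | inj₂ (e , e∈K , e∉A) with edge-side {K = K} K⊑G e e∈K
    ...   | inj₁ e∈A = ⊥-elim (e∉A e∈A)
    ...   | inj₂ e∈C = end₁ e , proj₁ (wfK e e∈K) ,
                       λ t → w∉K (subst (_∈V K) (meet _ (proj₂ (∈-∩⁻ (V K) (V A) _ t)) (proj₁ (wfC e e∈C))) (proj₁ (wfK e e∈K)))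
    no-leaving : LeavingEdge K X → ⊥
    no-leaving (leaving {e} {a} {b} e∈K j a∈X b∈K b∉X) with edge-side {K = K} K⊑G e e∈K
    ... | inj₁ e∈A = b∉X (∈-∩⁺ (V K) (V A) b b∈K (proj₂ (WellFormed-joins {H = A} wfA e∈A j)))
    ... | inj₂ e∈C = let a∈K , a∈A = ∈-∩⁻ (V K) (V A) a a∈X in
                     w∉K (subst (_∈V K) (meet a a∈A (proj₁ (WellFormed-joins {H = C} wfC e∈C j))) a∈K)

  inside-A : List (Fin n) → SG n → Bool
  inside-A ws K = CS G ws K ∧ (K ≼ A)

  outside-A : List (Fin n) → SG n → Bool
  outside-A ws K = CS G ws K ∧ not (K ≼ A)

  through-w : List (Fin n) → SG n → Bool
  through-w ws K = outside-A ws K ∧ lookup (V K) w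

  avoiding-w : List (Fin n) → SG n → Bool
  avoiding-w ws K = outside-A ws K ∧ not (lookup (V K) w)

  C-part : SG n → Bool
  C-part K = CS C [ w ] K ∧ not (K ≼ A)

  private
    CS⇒ : ∀ H ws K → T (CS H ws K) → ConnectedSubgraph H ws K
    CS⇒ H ws K = isConnectedSubgraph⇒ {H = H} {ws} {K}

    ⇒CS : ∀ H ws K → ConnectedSubgraph H ws K → T (CS H ws K)
    ⇒CS H ws K = ⇒isConnectedSubgraph {H = H} {ws} {K}

    outside-A⇒ : ∀ {ws K} → T (outside-A ws K) → ConnectedSubgraph G ws K × ¬ T (K ≼ A)
    outside-A⇒ {ws} {K} t = let cs , K⋢A = to (T-∧ {CS G ws K}) t in CS⇒ G ws K cs , T-not⁻ K⋢A

    through-w⇒ : ∀ {ws K} → T (through-w ws K) → ConnectedSubgraph G ws K × ¬ T (K ≼ A) × w ∈V K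
    through-w⇒ {ws} {K} t = let outside , w∈K = to (T-∧ {outside-A ws K}) t ; c , K⋢A = outside-A⇒ outside in c , K⋢A , w∈K

    avoiding-w⇒ : ∀ {ws K} → T (avoiding-w ws K) → ConnectedSubgraph G ws K × ¬ T (K ≼ A) × ¬ w ∈V K
    avoiding-w⇒ {ws} {K} t = let outside , w∉K = to (T-∧ {outside-A ws K}) t ; c , K⋢A = outside-A⇒ outside in c , K⋢A , T-not⁻ w∉K

    C-part⇒ : ∀ {K} → T (C-part K) → ConnectedSubgraph C [ w ] K × ¬ T (K ≼ A)
    C-part⇒ {K} t = let cs , K⋢A = to (T-∧ {CS C [ w ] K}) t in CS⇒ C [ w ] K cs , T-not⁻ K⋢A

  count-inside-A : ∀ ws → countGraphs (inside-A ws) ≡ fc A ws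
  count-inside-A ws = trans (countᵇ-≗ ⇒A A⇒ (elements (graphs n))) (sym (fc≡countGraphs A ws))
    where
    ⇒A : ∀ K → T (inside-A ws K) → T (CS A ws K)
    ⇒A K t with to (T-∧ {CS G ws K}) t
    ... | cs , K≼A = let c = CS⇒ G ws K cs in ⇒CS A ws K (connectedSubgraph (wellFormed c) (≼⇒⊑ {H = K} {A} K≼A) (conn c) (through c))
    A⇒ : ∀ K → T (CS A ws K) → T (inside-A ws K)
    A⇒ K t = let c = CS⇒ A ws K t in
      from T-∧ (⇒CS G ws K (connectedSubgraph (wellFormed c) (⊑-trans {H = K} {A} {G} (⊑host c) (⊑-∪ᴳˡ {H = A} {C})) (conn c) (through c))
               , ⊑⇒≼ {H = K} {A} (⊑host c))

  count-C-inside-A : countGraphs (λ K → CS C [ w ] K ∧ (K ≼ A)) ≡ 1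
  count-C-inside-A = countᵇ-bijection (graphs n) unit (λ _ → tt) (λ _ → point w) (λ _ _ → tt) point-counted
                                      point-unique (λ { tt _ → refl })
    where
    point-counted : ∀ u → T true → T (CS C [ w ] (point w) ∧ (point w ≼ A))
    point-counted _ _ = from T-∧ (⇒CS C [ w ] (point w) (connectedSubgraph (point-WellFormed w) (point-⊑ {w = w} {C} w∈C) (point-connected w)
                                                       λ { (here refl) → ∈-singletonV⁺ w ; (there ()) })
                                 , ⊑⇒≼ {H = point w} {A} (point-⊑ {w = w} {A} w∈A))
    point-unique : ∀ K → T (CS C [ w ] K ∧ (K ≼ A)) → point w ≡ K
    point-unique K t with to (T-∧ {CS C [ w ] K}) t
    ... | cs , K≼A = sym (⊑-point {w = w} {K} (through c (here refl)) (λ v v∈K → meet v (proj₁ K⊑A v v∈K) (proj₁ (⊑host c) v v∈K))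
                                  (λ e e∈K → edge-disjoint e (proj₂ K⊑A e e∈K) (proj₂ (⊑host c) e e∈K)))
      where
      c : ConnectedSubgraph C [ w ] K
      c = CS⇒ C [ w ] K cs
      K⊑A : K ⊑ A
      K⊑A = ≼⇒⊑ {H = K} {A} K≼A

  count-C-part : countGraphs C-part ≡ fc C [ w ] ∸ 1
  count-C-part = sym (cong (_∸ 1) (begin
    fc C [ w ]                                                  ≡⟨ fc≡countGraphs C [ w ] ⟩
    countGraphs (CS C [ w ])                                    ≡⟨ countᵇ-split _ (_≼ A) (elements (graphs n)) ⟩
    countGraphs (λ K → CS C [ w ] K ∧ (K ≼ A)) + countGraphs C-part ≡⟨ cong (_+ countGraphs C-part) count-C-inside-A ⟩
    suc (countGraphs C-part)                                    ∎))

  module _ (ws : List (Fin n)) (ws⊆A : ∀ v → v ∈ ws → v ∈V A) where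

    private
      split-pair : SG n × SG n → Bool
      split-pair (K₁ , K₂) = CS A (ws ++ [ w ]) K₁ ∧ C-part K₂

      split-pair⇒ : ∀ {K₁ K₂} → T (split-pair (K₁ , K₂)) →
                    ConnectedSubgraph A (ws ++ [ w ]) K₁ × ConnectedSubgraph C [ w ] K₂ × ¬ T (K₂ ≼ A)
      split-pair⇒ {K₁} {K₂} t = let cs₁ , t₂ = to (T-∧ {CS A (ws ++ [ w ]) K₁}) t ; c₂ , K₂⋢A = C-part⇒ {K₂} t₂ in
                                CS⇒ A (ws ++ [ w ]) K₁ cs₁ , c₂ , K₂⋢A

      split : SG n → SG n × SG n
      split K = K ∩ᴳ A , K ∩ᴳ C

      join : SG n × SG n → SG n
      join (K₁ , K₂) = K₁ ∪ᴳ K₂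

      split-counted : ∀ K → T (through-w ws K) → T (split-pair (split K))
      split-counted K t with through-w⇒ {ws} {K} t
      ... | c , K⋢A , w∈K =
        from T-∧ (⇒CS A (ws ++ [ w ]) (K ∩ᴳ A) A-part , from T-∧ (⇒CS C [ w ] (K ∩ᴳ C) C-part′ , T-not⁺ C-part⋢A))
        where
        A-part : ConnectedSubgraph A (ws ++ [ w ]) (K ∩ᴳ A)
        A-part = connectedSubgraph (WellFormed-∩ᴳ {H = K} {A} (wellFormed c) wfA) (∩ᴳ-⊑ʳ {H = K} {A})
          (connected-∩ᴳ {K = K} {A} {C} w (conn c) (edge-side {K = K} (⊑host c)) wfA wfC meet w∈K w∈A) through-ws+w
          where
          through-ws+w : ∀ {v} → v ∈ ws ++ [ w ] → v ∈V K ∩ᴳ A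
          through-ws+w {v} m with ∈-++⁻ ws m
          ... | inj₁ v∈ws = ∈-∩⁺ (V K) (V A) v (through c v∈ws) (ws⊆A v v∈ws)
          ... | inj₂ (here refl) = ∈-∩⁺ (V K) (V A) v w∈K w∈A
        C-part′ : ConnectedSubgraph C [ w ] (K ∩ᴳ C)
        C-part′ = connectedSubgraph (WellFormed-∩ᴳ {H = K} {C} (wellFormed c) wfC) (∩ᴳ-⊑ʳ {H = K} {C})
          (connected-∩ᴳ {K = K} {C} {A} w (conn c) (λ e → swap ∘ edge-side {K = K} (⊑host c) e) wfC wfA meet′ w∈K w∈C)
          λ { (here refl) → ∈-∩⁺ (V K) (V C) w w∈K w∈C ; (there ()) }
        C-part⋢A : ¬ T ((K ∩ᴳ C) ≼ A)
        C-part⋢A K∩C≼A with ≼⇒⊑ {H = K ∩ᴳ C} {A} K∩C≼A | ⋢⇒witness {H = K} {A} K⋢A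
        ... | vA , _ | inj₁ (v , v∈K , v∉A) =
          v∉A ([ (λ v∈A → v∈A) , (λ v∈C → vA v (∈-∩⁺ (V K) (V C) v v∈K v∈C)) ]′ (vertex-side {K = K} (⊑host c) v v∈K))
        ... | _ , eA | inj₂ (e , e∈K , e∉A) =
          e∉A ([ (λ e∈A → e∈A) , (λ e∈C → eA e (∈-∩⁺ (E K) (E C) e e∈K e∈C)) ]′ (edge-side {K = K} (⊑host c) e e∈K))

      join-counted : ∀ K₁K₂ → T (split-pair K₁K₂) → T (through-w ws (join K₁K₂))
      join-counted (K₁ , K₂) t with split-pair⇒ {K₁} {K₂} t
      ... | c₁ , c₂ , K₂⋢A =
        from T-∧ (from T-∧ (⇒CS G ws (K₁ ∪ᴳ K₂) joined , T-not⁺ joined⋢A) , ∈-∪⁺ˡ (V K₁) (V K₂) w w∈K₁)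
        where
        w∈K₁ : w ∈V K₁
        w∈K₁ = through c₁ (∈-++⁺ʳ ws (here refl))
        joined : ConnectedSubgraph G ws (K₁ ∪ᴳ K₂)
        joined = connectedSubgraph (WellFormed-∪ᴳ {H = K₁} {K₂} (wellFormed c₁) (wellFormed c₂))
          (∪ᴳ-least {H = K₁} {K₂} {G} (⊑-trans {H = K₁} {A} {G} (⊑host c₁) (⊑-∪ᴳˡ {H = A} {C}))
                                    (⊑-trans {H = K₂} {C} {G} (⊑host c₂) (⊑-∪ᴳʳ {H = A} {C})))
          (connected-∪ᴳ {H = K₁} {K₂} w (conn c₁) (conn c₂) w∈K₁ (through c₂ (here refl)))
          (λ m → ∈-∪⁺ˡ (V K₁) (V K₂) _ (through c₁ (∈-++⁺ˡ m)))
        joined⋢A : ¬ T ((K₁ ∪ᴳ K₂) ≼ A)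
        joined⋢A t′ =
          K₂⋢A (⊑⇒≼ {H = K₂} {A} (⊑-trans {H = K₂} {K₁ ∪ᴳ K₂} {A} (⊑-∪ᴳʳ {H = K₁} {K₂}) (≼⇒⊑ {H = K₁ ∪ᴳ K₂} {A} t′)))

      join∘split : ∀ K → T (through-w ws K) → join (split K) ≡ K
      join∘split K t = ∩ᴳ-∪ᴳ-distrib-cover {K = K} {A} {C} (⊑host (proj₁ (through-w⇒ {ws} {K} t)))

      split∘join : ∀ K₁K₂ → T (split-pair K₁K₂) → split (join K₁K₂) ≡ K₁K₂
      split∘join (K₁ , K₂) t with split-pair⇒ {K₁} {K₂} t
      ... | c₁ , c₂ , _ = cong₂ _,_
        (∪ᴳ-∩ᴳ-absorbˡ {K₁ = K₁} {K₂} {A} (⊑host c₁)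
          (λ v v∈K₂ v∈A → subst (_∈V K₁) (sym (meet v v∈A (proj₁ (⊑host c₂) v v∈K₂))) (through c₁ (∈-++⁺ʳ ws (here refl))))
          (λ e e∈K₂ e∈A → ⊥-elim (edge-disjoint e e∈A (proj₂ (⊑host c₂) e e∈K₂))))
        (∪ᴳ-∩ᴳ-absorbʳ {K₁ = K₁} {K₂} {C} (⊑host c₂)
          (λ v v∈K₁ v∈C → subst (_∈V K₂) (sym (meet v (proj₁ (⊑host c₁) v v∈K₁) v∈C)) (through c₂ (here refl)))
          (λ e e∈K₁ e∈C → ⊥-elim (edge-disjoint e (proj₂ (⊑host c₁) e e∈K₁) e∈C)))

    count-through-w : countGraphs (through-w ws) ≡ fc A (ws ++ [ w ]) * countGraphs C-part
    count-through-w = begin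
      countGraphs (through-w ws)
        ≡⟨ countᵇ-bijection (graphs n) (graphs n ×ᴱ graphs n) split join split-counted join-counted join∘split split∘join ⟩
      countᵇ split-pair (elements (graphs n ×ᴱ graphs n))
        ≡⟨ countᵇ-cartesianProduct (CS A (ws ++ [ w ])) C-part (elements (graphs n)) (elements (graphs n)) ⟩
      countGraphs (CS A (ws ++ [ w ])) * countGraphs C-part
        ≡⟨ cong (_* countGraphs C-part) (sym (fc≡countGraphs A (ws ++ [ w ]))) ⟩
      fc A (ws ++ [ w ]) * countGraphs C-part ∎

  count-avoiding-w-through : ∀ ws {v₀} → v₀ ∈ ws → (∀ v → v ∈ ws → v ∈V A) → countGraphs (avoiding-w ws) ≡ 0
  count-avoiding-w-through ws {v₀} v₀∈ws ws⊆A = countᵇ-none uncounted (elements (graphs n))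
    where
    uncounted : ∀ K → ¬ T (avoiding-w ws K)
    uncounted K t with avoiding-w⇒ {ws} {K} t
    ... | c , K⋢A , w∉K = misses-A {K} (wellFormed c) (conn c) (⊑host c) K⋢A w∉K v₀ (through c v₀∈ws) (ws⊆A v₀ v₀∈ws)

  count-avoiding-w : countGraphs (avoiding-w []) ≡ Fc C ∸ fc C [ w ]
  count-avoiding-w = begin
    countGraphs (avoiding-w [])                                   ≡⟨ countᵇ-≗ ⇒C C⇒ (elements (graphs n)) ⟩
    countGraphs (λ K → CS C [] K ∧ not (lookup (V K) w))          ≡⟨ sym (m+n∸m≡n (fc C [ w ]) _) ⟩
    fc C [ w ] + countGraphs (λ K → CS C [] K ∧ not (lookup (V K) w)) ∸ fc C [ w ] ≡⟨ cong (_∸ fc C [ w ]) (sym (Fc≡fc+avoiding C w)) ⟩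
    Fc C ∸ fc C [ w ]                                             ∎
    where
    ⇒C : ∀ K → T (avoiding-w [] K) → T (CS C [] K ∧ not (lookup (V K) w))
    ⇒C K t with avoiding-w⇒ {[]} {K} t
    ... | c , K⋢A , w∉K = from T-∧ (⇒CS C [] K (connectedSubgraph (wellFormed c) (in-C-V , in-C-E) (conn c) λ ()) , T-not⁺ w∉K)
      where
      off-A : ∀ v → v ∈V K → ¬ v ∈V A
      off-A = misses-A {K} (wellFormed c) (conn c) (⊑host c) K⋢A w∉K
      in-C-V : V K ⊆ₛ V C
      in-C-V v v∈K = [ (λ v∈A → ⊥-elim (off-A v v∈K v∈A)) , (λ v∈C → v∈C) ]′ (vertex-side {K = K} (⊑host c) v v∈K)
      in-C-E : E K ⊆ₛ E C
      in-C-E e e∈K = [ (λ e∈A → ⊥-elim (off-A (end₁ e) (proj₁ (wellFormed c e e∈K)) (proj₁ (wfA e e∈A)))) , (λ e∈C → e∈C) ]′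
                       (edge-side {K = K} (⊑host c) e e∈K)
    C⇒ : ∀ K → T (CS C [] K ∧ not (lookup (V K) w)) → T (avoiding-w [] K)
    C⇒ K t with to (T-∧ {CS C [] K}) t
    ... | cs , w∉K = from T-∧ (from T-∧ (⇒CS G [] K (connectedSubgraph (wellFormed c) (⊑-trans {H = K} {C} {G} (⊑host c) (⊑-∪ᴳʳ {H = A} {C}))
                                                                (conn c) λ ()) , T-not⁺ K⋢A) , w∉K)
      where
      c : ConnectedSubgraph C [] K
      c = CS⇒ C [] K cs
      K⋢A : ¬ T (K ≼ A)
      K⋢A K≼A with proj₁ (connected⇒Connected {K = K} (conn c))
      ... | v , v∈K = T-not⁻ w∉K (subst (_∈V K) (meet v (proj₁ (≼⇒⊑ {H = K} {A} K≼A) v v∈K) (proj₁ (⊑host c) v v∈K)) v∈K)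

  private
    count-outside-A : ∀ ws → countGraphs (CS G ws) ≡ fc A ws + (countGraphs (through-w ws) + countGraphs (avoiding-w ws))
    count-outside-A ws = begin
      countGraphs (CS G ws)                                     ≡⟨ countᵇ-split _ (_≼ A) (elements (graphs n)) ⟩
      countGraphs (inside-A ws) + countGraphs (outside-A ws)    ≡⟨ cong₂ _+_ (count-inside-A ws)
                                                                     (countᵇ-split _ (λ K → lookup (V K) w) (elements (graphs n))) ⟩
      fc A ws + (countGraphs (through-w ws) + countGraphs (avoiding-w ws)) ∎

  fc-glue : ∀ ws {v₀} → v₀ ∈ ws → (∀ v → v ∈ ws → v ∈V A) → fc G ws ≡ fc A ws + fc A (ws ++ [ w ]) * (fc C [ w ] ∸ 1)
  fc-glue ws v₀∈ws ws⊆A = begin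
    fc G ws                                                                    ≡⟨ fc≡countGraphs G ws ⟩
    countGraphs (CS G ws)                                                      ≡⟨ count-outside-A ws ⟩
    fc A ws + (countGraphs (through-w ws) + countGraphs (avoiding-w ws))       ≡⟨ cong (λ k → fc A ws + (countGraphs (through-w ws) + k))
                                                                                     (count-avoiding-w-through ws v₀∈ws ws⊆A) ⟩
    fc A ws + (countGraphs (through-w ws) + 0)                                 ≡⟨ cong (fc A ws +_) (+-identityʳ _) ⟩
    fc A ws + countGraphs (through-w ws)                                       ≡⟨ cong (fc A ws +_) (count-through-w ws ws⊆A) ⟩
    fc A ws + fc A (ws ++ [ w ]) * countGraphs C-part                          ≡⟨ cong (λ k → fc A ws + fc A (ws ++ [ w ]) * k) count-C-part ⟩
    fc A ws + fc A (ws ++ [ w ]) * (fc C [ w ] ∸ 1)                            ∎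

  Fc-glue : Fc G ≡ Fc A + fc A [ w ] * (fc C [ w ] ∸ 1) + (Fc C ∸ fc C [ w ])
  Fc-glue = begin
    Fc G                                                                       ≡⟨ fc≡countGraphs G [] ⟩
    countGraphs (CS G [])                                                      ≡⟨ count-outside-A [] ⟩
    Fc A + (countGraphs (through-w []) + countGraphs (avoiding-w []))          ≡⟨ cong₂ (λ a b → Fc A + (a + b))
                                                                                     (count-through-w [] (λ _ ())) count-avoiding-w ⟩
    Fc A + (fc A [ w ] * countGraphs C-part + (Fc C ∸ fc C [ w ]))             ≡⟨ cong (λ k → Fc A + (fc A [ w ] * k + (Fc C ∸ fc C [ w ])))
                                                                                     count-C-part ⟩
    Fc A + (fc A [ w ] * (fc C [ w ] ∸ 1) + (Fc C ∸ fc C [ w ]))               ≡⟨ sym (+-assoc (Fc A) _ _) ⟩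
    Fc A + fc A [ w ] * (fc C [ w ] ∸ 1) + (Fc C ∸ fc C [ w ])                 ∎

-- Sums over subsets


module _ {A : Set} where

  sum-map-cong : ∀ {f g : A → ℕ} → (∀ x → f x ≡ g x) → ∀ xs → sum (map f xs) ≡ sum (map g xs)
  sum-map-cong f≗g [] = refl
  sum-map-cong f≗g (x ∷ xs) = cong₂ _+_ (f≗g x) (sum-map-cong f≗g xs)

  sum-map-+ : ∀ (f g : A → ℕ) xs → sum (map (λ x → f x + g x) xs) ≡ sum (map f xs) + sum (map g xs)
  sum-map-+ f g [] = refl
  sum-map-+ f g (x ∷ xs) = trans (cong (f x + g x +_) (sum-map-+ f g xs)) (interchange (f x) (g x) _ _)

  sum-map-*ʳ : ∀ (f : A → ℕ) c xs → sum (map (λ x → f x * c) xs) ≡ sum (map f xs) * c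
  sum-map-*ʳ f c [] = refl
  sum-map-*ʳ f c (x ∷ xs) = trans (cong (f x * c +_) (sum-map-*ʳ f c xs)) (sym (*-distribʳ-+ c (f x) _))

  sum-map-filterᵇ : ∀ (f : A → ℕ) (p : A → Bool) xs → sum (map f (filterᵇ p xs)) ≡ sum (map (λ x → if p x then f x else 0) xs)
  sum-map-filterᵇ f p [] = refl
  sum-map-filterᵇ f p (x ∷ xs) with p x
  ... | true = cong (f x +_) (sum-map-filterᵇ f p xs)
  ... | false = sum-map-filterᵇ f p xs

  sum-map-concatMap : ∀ {B : Set} (f : B → ℕ) (g : A → List B) xs → sum (map f (concatMap g xs)) ≡ sum (map (λ x → sum (map f (g x))) xs)
  sum-map-concatMap f g [] = refl
  sum-map-concatMap f g (x ∷ xs) = begin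
    sum (map f (g x ++ concatMap g xs))              ≡⟨ cong sum (map-++ f (g x) (concatMap g xs)) ⟩
    sum (map f (g x) ++ map f (concatMap g xs))      ≡⟨ sum-++ (map f (g x)) _ ⟩
    sum (map f (g x)) + sum (map f (concatMap g xs)) ≡⟨ cong (sum (map f (g x)) +_) (sum-map-concatMap f g xs) ⟩
    sum (map (λ x → sum (map f (g x))) (x ∷ xs))     ∎

filterᵇ-map : ∀ {A B : Set} (p : B → Bool) (f : A → B) xs → filterᵇ p (map f xs) ≡ map f (filterᵇ (p ∘ f) xs)
filterᵇ-map p f [] = refl
filterᵇ-map p f (x ∷ xs) with p (f x)
... | true = cong (f x ∷_) (filterᵇ-map p f xs)
... | false = filterᵇ-map p f xs

size : ∀ {s} → Vec Bool s → ℕ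
size S = length (select S)

module _ {s : ℕ} (X : Vec Bool s) where

  select-true : select (true ∷ X) ≡ fzero ∷ map fsuc (select X)
  select-true = cong (fzero ∷_) (trans (cong (filterᵇ (lookup (true ∷ X))) (sym (map-tabulate id fsuc))) (filterᵇ-map _ fsuc (allFin s)))

  select-false : select (false ∷ X) ≡ map fsuc (select X)
  select-false = trans (cong (filterᵇ (lookup (false ∷ X))) (sym (map-tabulate id fsuc))) (filterᵇ-map _ fsuc (allFin s))

  size-true : size (true ∷ X) ≡ suc (size X)
  size-true = trans (cong length select-true) (cong suc (length-map fsuc (select X)))

  size-false : size (false ∷ X) ≡ size X
  size-false = trans (cong length select-false) (length-map fsuc (select X))

select-∅ : ∀ s → select (replicate s false) ≡ []
select-∅ zero = refl
select-∅ (suc s) = trans (select-false (replicate s false)) (cong (map fsuc) (select-∅ s))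

select-⁅⁆ : ∀ {s} (i : Fin s) → select ⁅ i ⁆ ≡ [ i ]
select-⁅⁆ {suc s} fzero = trans (select-true (replicate s false)) (cong (fzero ∷_) (cong (map fsuc) (select-∅ s)))
select-⁅⁆ {suc s} (fsuc i) = trans (select-false ⁅ i ⁆) (cong (map fsuc) (select-⁅⁆ i))

rebalance : ∀ F f b → 1 ≤ b → 1 ≤ f → f ≤ F → (F ∸ f) + b * (f ∸ 1) ≡ (F ∸ 1) + (b ∸ 1) * (f ∸ 1)
rebalance F (suc f) (suc b) (s≤s z≤n) (s≤s z≤n) f≤F with m≤n⇒∃[o]m+o≡n f≤F
... | r , refl = trans (cong (_+ suc b * f) (m+n∸m≡n (suc f) r))
                       (solve 3 (λ f b r → r :+ (f :+ b :* f) := (f :+ r) :+ b :* f) refl f b r)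
  where open +-*-Solver

regroup-singletons : ∀ {A : Set} (F f b : A → ℕ) → (∀ i → 1 ≤ b i) → (∀ i → 1 ≤ f i) → (∀ i → f i ≤ F i) → ∀ xs →
  sum (map (λ i → F i ∸ f i) xs) + sum (map (λ i → b i * (f i ∸ 1)) xs) ≡
  sum (map (λ i → F i ∸ 1) xs) + sum (map (λ i → (b i ∸ 1) * (f i ∸ 1)) xs)
regroup-singletons F f b 1≤b 1≤f f≤F xs = begin
  sum (map (λ i → F i ∸ f i) xs) + sum (map (λ i → b i * (f i ∸ 1)) xs) ≡⟨ sym (sum-map-+ _ _ xs) ⟩
  sum (map (λ i → (F i ∸ f i) + b i * (f i ∸ 1)) xs)
    ≡⟨ sum-map-cong (λ i → rebalance (F i) (f i) (b i) (1≤b i) (1≤f i) (f≤F i)) xs ⟩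
  sum (map (λ i → (F i ∸ 1) + (b i ∸ 1) * (f i ∸ 1)) xs)                ≡⟨ sum-map-+ _ _ xs ⟩
  sum (map (λ i → F i ∸ 1) xs) + sum (map (λ i → (b i ∸ 1) * (f i ∸ 1)) xs) ∎

Σ⊆ : ∀ s → (Vec Bool s → ℕ) → ℕ
Σ⊆ s F = sum (map F (allSubsets s))

Σ⊆[≥_] : ℕ → ∀ s → (Vec Bool s → ℕ) → ℕ
Σ⊆[≥ k ] s F = sum (map F (filterᵇ (λ S → k ≤ᵇ size S) (allSubsets s)))

Σ⊆-cong : ∀ s {F G : Vec Bool s → ℕ} → (∀ S → F S ≡ G S) → Σ⊆ s F ≡ Σ⊆ s G
Σ⊆-cong s F≗G = sum-map-cong F≗G (allSubsets s)

Σ⊆-suc : ∀ s (F : Vec Bool (suc s) → ℕ) → Σ⊆ (suc s) F ≡ Σ⊆ s (F ∘ (true ∷_)) + Σ⊆ s (F ∘ (false ∷_))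
Σ⊆-suc s F = begin
  Σ⊆ (suc s) F                                           ≡⟨ sum-map-concatMap F (λ X → (true ∷ X) ∷ (false ∷ X) ∷ []) (allSubsets s) ⟩
  Σ⊆ s (λ X → F (true ∷ X) + (F (false ∷ X) + 0))        ≡⟨ Σ⊆-cong s (λ X → cong (F (true ∷ X) +_) (+-identityʳ _)) ⟩
  Σ⊆ s (λ X → F (true ∷ X) + F (false ∷ X))              ≡⟨ sum-map-+ _ _ (allSubsets s) ⟩
  Σ⊆ s (F ∘ (true ∷_)) + Σ⊆ s (F ∘ (false ∷_))           ∎

private
  suc-≤ᵇ-suc : ∀ k m → (suc k ≤ᵇ suc m) ≡ (k ≤ᵇ m)
  suc-≤ᵇ-suc zero m = refl
  suc-≤ᵇ-suc (suc k) m = refl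

  Σ⊆[≥]-as-Σ⊆ : ∀ k s F → Σ⊆[≥ k ] s F ≡ Σ⊆ s (λ S → if k ≤ᵇ size S then F S else 0)
  Σ⊆[≥]-as-Σ⊆ k s F = sum-map-filterᵇ F _ (allSubsets s)

Σ⊆[≥0] : ∀ s F → Σ⊆[≥ 0 ] s F ≡ Σ⊆ s F
Σ⊆[≥0] s F = Σ⊆[≥]-as-Σ⊆ 0 s F

Σ⊆[≥]-suc : ∀ k s (F : Vec Bool (suc s) → ℕ) →
            Σ⊆[≥ suc k ] (suc s) F ≡ Σ⊆[≥ k ] s (F ∘ (true ∷_)) + Σ⊆[≥ suc k ] s (F ∘ (false ∷_))
Σ⊆[≥]-suc k s F = begin
  Σ⊆[≥ suc k ] (suc s) F
    ≡⟨ Σ⊆[≥]-as-Σ⊆ (suc k) (suc s) F ⟩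
  Σ⊆ (suc s) (λ S → if suc k ≤ᵇ size S then F S else 0)
    ≡⟨ Σ⊆-suc s _ ⟩
  Σ⊆ s (λ X → if suc k ≤ᵇ size (true ∷ X) then F (true ∷ X) else 0)
    + Σ⊆ s (λ X → if suc k ≤ᵇ size (false ∷ X) then F (false ∷ X) else 0)
    ≡⟨ cong₂ _+_ (Σ⊆-cong s λ X → cong (λ m → if suc k ≤ᵇ m then F (true ∷ X) else 0) (size-true X))
                 (Σ⊆-cong s λ X → cong (λ m → if suc k ≤ᵇ m then F (false ∷ X) else 0) (size-false X)) ⟩
  Σ⊆ s (λ X → if suc k ≤ᵇ suc (size X) then F (true ∷ X) else 0) + Σ⊆ s (λ X → if suc k ≤ᵇ size X then F (false ∷ X) else 0)
    ≡⟨ cong (_+ Σ⊆ s (λ X → if suc k ≤ᵇ size X then F (false ∷ X) else 0))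
            (Σ⊆-cong s λ X → cong (λ b → if b then F (true ∷ X) else 0) (suc-≤ᵇ-suc k (size X))) ⟩
  Σ⊆ s (λ X → if k ≤ᵇ size X then F (true ∷ X) else 0) + Σ⊆ s (λ X → if suc k ≤ᵇ size X then F (false ∷ X) else 0)
    ≡⟨ sym (cong₂ _+_ (Σ⊆[≥]-as-Σ⊆ k s _) (Σ⊆[≥]-as-Σ⊆ (suc k) s _)) ⟩
  Σ⊆[≥ k ] s (F ∘ (true ∷_)) + Σ⊆[≥ suc k ] s (F ∘ (false ∷_)) ∎

Σ⊆-split-∅ : ∀ s F → Σ⊆ s F ≡ F (replicate s false) + Σ⊆[≥ 1 ] s F
Σ⊆-split-∅ zero F = refl
Σ⊆-split-∅ (suc s) F = begin
  Σ⊆ (suc s) F                        ≡⟨ Σ⊆-suc s F ⟩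
  with-0 + Σ⊆ s (F ∘ (false ∷_))      ≡⟨ cong (with-0 +_) (Σ⊆-split-∅ s (F ∘ (false ∷_))) ⟩
  with-0 + (F ∅ + rest)               ≡⟨ sym (+-assoc with-0 (F ∅) rest) ⟩
  with-0 + F ∅ + rest                 ≡⟨ cong (_+ rest) (+-comm with-0 (F ∅)) ⟩
  F ∅ + with-0 + rest                 ≡⟨ +-assoc (F ∅) with-0 rest ⟩
  F ∅ + (with-0 + rest)               ≡⟨ cong (λ m → F ∅ + (m + rest)) (sym (Σ⊆[≥0] s _)) ⟩
  F ∅ + (Σ⊆[≥ 0 ] s (F ∘ (true ∷_)) + rest) ≡⟨ cong (F ∅ +_) (sym (Σ⊆[≥]-suc 0 s F)) ⟩
  F ∅ + Σ⊆[≥ 1 ] (suc s) F            ∎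
  where
  ∅ : Vec Bool (suc s)
  ∅ = replicate (suc s) false
  with-0 rest : ℕ
  with-0 = Σ⊆ s (F ∘ (true ∷_))
  rest = Σ⊆[≥ 1 ] s (F ∘ (false ∷_))

Σ⊆[≥1]-split-singletons : ∀ s F → Σ⊆[≥ 1 ] s F ≡ sum (map (λ i → F ⁅ i ⁆) (allFin s)) + Σ⊆[≥ 2 ] s F
Σ⊆[≥1]-split-singletons zero F = refl
Σ⊆[≥1]-split-singletons (suc s) F = begin
  Σ⊆[≥ 1 ] (suc s) F
    ≡⟨ Σ⊆[≥]-suc 0 s F ⟩
  Σ⊆[≥ 0 ] s (F ∘ (true ∷_)) + Σ⊆[≥ 1 ] s (F ∘ (false ∷_))
    ≡⟨ cong₂ _+_ (trans (Σ⊆[≥0] s _) (Σ⊆-split-∅ s _)) (Σ⊆[≥1]-split-singletons s (F ∘ (false ∷_))) ⟩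
  (F ⁅ fzero ⁆ + Σ⊆[≥ 1 ] s (F ∘ (true ∷_))) + (singles + Σ⊆[≥ 2 ] s (F ∘ (false ∷_)))
    ≡⟨ interchange (F ⁅ fzero ⁆) (Σ⊆[≥ 1 ] s (F ∘ (true ∷_))) singles (Σ⊆[≥ 2 ] s (F ∘ (false ∷_))) ⟩
  (F ⁅ fzero ⁆ + singles) + (Σ⊆[≥ 1 ] s (F ∘ (true ∷_)) + Σ⊆[≥ 2 ] s (F ∘ (false ∷_)))
    ≡⟨ cong₂ _+_ (cong (F ⁅ fzero ⁆ +_) (cong sum (map-∘ (allFin s)))) (sym (Σ⊆[≥]-suc 1 s F)) ⟩
  (F ⁅ fzero ⁆ + sum (map (λ i → F ⁅ i ⁆) (map fsuc (allFin s)))) + Σ⊆[≥ 2 ] (suc s) F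
    ≡⟨ cong (λ is → sum (map (λ i → F ⁅ i ⁆) (fzero ∷ is)) + Σ⊆[≥ 2 ] (suc s) F) (map-tabulate id fsuc) ⟩
  sum (map (λ i → F ⁅ i ⁆) (allFin (suc s))) + Σ⊆[≥ 2 ] (suc s) F ∎
  where
  singles : ℕ
  singles = sum (map (λ i → F ⁅ fsuc i ⁆) (allFin s))

module _ {A : Set} (f : List A → ℕ) where

  term : ∀ {s} → (Fin s → A) → (Fin s → ℕ) → List A → Vec Bool s → ℕ
  term x c ws S = f (ws ++ map x (select S)) * product (map c (select S))

  module _ {s : ℕ} (x : Fin (suc s) → A) (c : Fin (suc s) → ℕ) (ws : List A) (X : Vec Bool s) where

    term-true : term x c ws (true ∷ X) ≡ term (x ∘ fsuc) (c ∘ fsuc) (ws ++ [ x fzero ]) X * c fzero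
    term-true = begin
      term x c ws (true ∷ X)
        ≡⟨ cong (λ S → f (ws ++ map x S) * product (map c S)) (select-true X) ⟩
      f (ws ++ x fzero ∷ map x (map fsuc (select X))) * (c fzero * product (map c (map fsuc (select X))))
        ≡⟨ cong₂ (λ l p → f l * (c fzero * product p))
                 (trans (cong (λ l → ws ++ x fzero ∷ l) (sym (map-∘ (select X)))) (sym (++-assoc ws [ x fzero ] _)))
                 (sym (map-∘ (select X))) ⟩
      a * (c fzero * p)  ≡⟨ cong (a *_) (*-comm (c fzero) p) ⟩
      a * (p * c fzero)  ≡⟨ sym (*-assoc a p (c fzero)) ⟩
      a * p * c fzero    ∎
      where
      a p : ℕ
      a = f ((ws ++ [ x fzero ]) ++ map (x ∘ fsuc) (select X))
      p = product (map (c ∘ fsuc) (select X))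

    term-false : term x c ws (false ∷ X) ≡ term (x ∘ fsuc) (c ∘ fsuc) ws X
    term-false = trans (cong (λ S → f (ws ++ map x S) * product (map c S)) (select-false X))
                       (cong₂ (λ l p → f (ws ++ l) * product p) (sym (map-∘ (select X))) (sym (map-∘ (select X))))

  term-⁅⁆ : ∀ {s} (x : Fin s → A) c (i : Fin s) → term x c [] ⁅ i ⁆ ≡ f [ x i ] * c i
  term-⁅⁆ x c i = trans (cong (λ S → f (map x S) * product (map c S)) (select-⁅⁆ i)) (cong (f [ x i ] *_) (*-identityʳ (c i)))

  -- Σ_{S ⊆ {0, …, s-1}} f(ws, x_S) · Π_{i ∈ S} c_i; for f = f_B, x = w and ws = [v₀] this is the right-hand side of (i).
  expansion : ∀ s → (Fin s → A) → (Fin s → ℕ) → List A → ℕ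
  expansion s x c ws = Σ⊆ s (term x c ws)

  expansion-suc : ∀ {s} (x : Fin (suc s) → A) c ws →
                  expansion (suc s) x c ws ≡ expansion s (x ∘ fsuc) (c ∘ fsuc) ws + expansion s (x ∘ fsuc) (c ∘ fsuc) (ws ++ [ x fzero ]) * c fzero
  expansion-suc {s} x c ws = begin
    expansion (suc s) x c ws
      ≡⟨ Σ⊆-suc s (term x c ws) ⟩
    Σ⊆ s (term x c ws ∘ (true ∷_)) + Σ⊆ s (term x c ws ∘ (false ∷_))
      ≡⟨ cong₂ _+_ (Σ⊆-cong s (term-true x c ws)) (Σ⊆-cong s (term-false x c ws)) ⟩
    Σ⊆ s (λ X → term x′ c′ (ws ++ [ x fzero ]) X * c fzero) + expansion s x′ c′ ws
      ≡⟨ cong (_+ expansion s x′ c′ ws) (sum-map-*ʳ _ (c fzero) (allSubsets s)) ⟩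
    expansion s x′ c′ (ws ++ [ x fzero ]) * c fzero + expansion s x′ c′ ws
      ≡⟨ +-comm (expansion s x′ c′ (ws ++ [ x fzero ]) * c fzero) (expansion s x′ c′ ws) ⟩
    expansion s x′ c′ ws + expansion s x′ c′ (ws ++ [ x fzero ]) * c fzero ∎
    where
    x′ : Fin s → A
    x′ = x ∘ fsuc
    c′ : Fin s → ℕ
    c′ = c ∘ fsuc

  nonempty-expansion-suc : ∀ {s} (x : Fin (suc s) → A) c →
                           Σ⊆[≥ 1 ] (suc s) (term x c []) ≡
                           expansion s (x ∘ fsuc) (c ∘ fsuc) [ x fzero ] * c fzero + Σ⊆[≥ 1 ] s (term (x ∘ fsuc) (c ∘ fsuc) [])
  nonempty-expansion-suc {s} x c = begin
    Σ⊆[≥ 1 ] (suc s) (term x c [])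
      ≡⟨ Σ⊆[≥]-suc 0 s (term x c []) ⟩
    Σ⊆[≥ 0 ] s (term x c [] ∘ (true ∷_)) + Σ⊆[≥ 1 ] s (term x c [] ∘ (false ∷_))
      ≡⟨ cong₂ _+_ (trans (Σ⊆[≥0] s _) (trans (Σ⊆-cong s (term-true x c [])) (sum-map-*ʳ _ (c fzero) (allSubsets s))))
                   (sum-map-cong (term-false x c []) (filterᵇ (λ S → 1 ≤ᵇ size S) (allSubsets s))) ⟩
    expansion s (x ∘ fsuc) (c ∘ fsuc) [ x fzero ] * c fzero + Σ⊆[≥ 1 ] s (term (x ∘ fsuc) (c ∘ fsuc) []) ∎

  nonempty-expansion-singletons : ∀ {s} (x : Fin s → A) c →
    Σ⊆[≥ 1 ] s (term x c []) ≡ sum (map (λ i → f [ x i ] * c i) (allFin s)) + Σ⊆[≥ 2 ] s (term x c [])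
  nonempty-expansion-singletons {s} x c =
    trans (Σ⊆[≥1]-split-singletons s (term x c [])) (cong (_+ Σ⊆[≥ 2 ] s (term x c [])) (sum-map-cong (term-⁅⁆ x c) (allFin s)))

-- Attaching branches to a graph

sum-allFin-suc : ∀ {s} (g : Fin (suc s) → ℕ) → sum (map g (allFin (suc s))) ≡ g fzero + sum (map (g ∘ fsuc) (allFin s))
sum-allFin-suc {s} g = cong (g fzero +_) (trans (cong sum (map-tabulate fsuc g)) (sym (cong sum (map-tabulate id (g ∘ fsuc)))))

branchWeight : ∀ {n s} → (Fin s → Fin n) → (Fin s → SG n) → Fin s → ℕ
branchWeight w Gi i = fc (Gi i) [ w i ] ∸ 1

module _ {n : ℕ} (B : SG n) where

  attach : ∀ s → (Fin s → SG n) → SG n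
  attach zero Gi = B
  attach (suc s) Gi = attach s (Gi ∘ fsuc) ∪ᴳ Gi fzero

  record Branches {s} (w : Fin s → Fin n) (Gi : Fin s → SG n) : Set where
    field
      branch-WellFormed : ∀ i → WellFormed (Gi i)
      root∈B : ∀ i → w i ∈V B
      root∈branch : ∀ i → w i ∈V Gi i
      branch-meets-B : ∀ i v → v ∈V Gi i → v ∈V B → v ≡ w i
      branches-disjoint : ∀ i j v → v ∈V Gi i → v ∈V Gi j → i ≡ j

  branches-tail : ∀ {s w Gi} → Branches {suc s} w Gi → Branches (w ∘ fsuc) (Gi ∘ fsuc)
  branches-tail br = record
    { branch-WellFormed = branch-WellFormed ∘ fsuc ; root∈B = root∈B ∘ fsuc ; root∈branch = root∈branch ∘ fsuc
    ; branch-meets-B = branch-meets-B ∘ fsuc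
    ; branches-disjoint = λ i j v v∈i v∈j → suc-injective (branches-disjoint (fsuc i) (fsuc j) v v∈i v∈j) }
    where open Branches br

  attach-WellFormed : WellFormed B → ∀ s Gi → (∀ i → WellFormed (Gi i)) → WellFormed (attach s Gi)
  attach-WellFormed wfB zero Gi wfGi = wfB
  attach-WellFormed wfB (suc s) Gi wfGi =
    WellFormed-∪ᴳ {H = attach s (Gi ∘ fsuc)} {Gi fzero} (attach-WellFormed wfB s (Gi ∘ fsuc) (wfGi ∘ fsuc)) (wfGi fzero)

  B⊑attach : ∀ s Gi → B ⊑ attach s Gi
  B⊑attach zero Gi = ⊑-refl {H = B}
  B⊑attach (suc s) Gi = ⊑-trans {H = B} {attach s (Gi ∘ fsuc)} {attach (suc s) Gi} (B⊑attach s (Gi ∘ fsuc))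
                                (⊑-∪ᴳˡ {H = attach s (Gi ∘ fsuc)} {Gi fzero})

  Gi⊑attach : ∀ s Gi i → Gi i ⊑ attach s Gi
  Gi⊑attach (suc s) Gi fzero = ⊑-∪ᴳʳ {H = attach s (Gi ∘ fsuc)} {Gi fzero}
  Gi⊑attach (suc s) Gi (fsuc i) =
    ⊑-trans {H = Gi (fsuc i)} {attach s (Gi ∘ fsuc)} {attach (suc s) Gi} (Gi⊑attach s (Gi ∘ fsuc) i)
            (⊑-∪ᴳˡ {H = attach s (Gi ∘ fsuc)} {Gi fzero})

  attach-vertex : ∀ s Gi v → v ∈V attach s Gi → v ∈V B ⊎ ∃ λ i → v ∈V Gi i
  attach-vertex zero Gi v v∈ = inj₁ v∈
  attach-vertex (suc s) Gi v v∈ with ∈-∪⁻ (V (attach s (Gi ∘ fsuc))) (V (Gi fzero)) v v∈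
  ... | inj₂ v∈G₀ = inj₂ (fzero , v∈G₀)
  ... | inj₁ v∈rest = Data.Sum.map₂ (λ (i , v∈Gi) → fsuc i , v∈Gi) (attach-vertex s (Gi ∘ fsuc) v v∈rest)

  attach-edge : ∀ s Gi e → e ∈E attach s Gi → e ∈E B ⊎ ∃ λ i → e ∈E Gi i
  attach-edge zero Gi e e∈ = inj₁ e∈
  attach-edge (suc s) Gi e e∈ with ∈-∪⁻ (E (attach s (Gi ∘ fsuc))) (E (Gi fzero)) e e∈
  ... | inj₂ e∈G₀ = inj₂ (fzero , e∈G₀)
  ... | inj₁ e∈rest = Data.Sum.map₂ (λ (i , e∈Gi) → fsuc i , e∈Gi) (attach-edge s (Gi ∘ fsuc) e e∈rest)

module _ {n : ℕ} {B : SG n} (B-WellFormed : WellFormed B) where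

  module AttachStep {s} {w : Fin (suc s) → Fin n} {Gi : Fin (suc s) → SG n} (br : Branches B w Gi) where
    open Branches br

    rest : SG n
    rest = attach B s (Gi ∘ fsuc)

    meet : ∀ v → v ∈V rest → v ∈V Gi fzero → v ≡ w fzero
    meet v v∈rest v∈G₀ with attach-vertex B s (Gi ∘ fsuc) v v∈rest
    ... | inj₁ v∈B = branch-meets-B fzero v v∈G₀ v∈B
    ... | inj₂ (i , v∈Gi) with branches-disjoint (fsuc i) fzero v v∈Gi v∈G₀
    ...   | ()

    edge-disjoint : ∀ e → e ∈E rest → e ∈E Gi fzero → ⊥
    edge-disjoint e e∈rest e∈G₀ with attach-edge B s (Gi ∘ fsuc) e e∈rest
    ... | inj₁ e∈B = ends-distinct {n} e
      (trans (branch-meets-B fzero _ (proj₁ (branch-WellFormed fzero e e∈G₀)) (proj₁ (B-WellFormed e e∈B)))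
             (sym (branch-meets-B fzero _ (proj₂ (branch-WellFormed fzero e e∈G₀)) (proj₂ (B-WellFormed e e∈B)))))
    ... | inj₂ (i , e∈Gi) with branches-disjoint (fsuc i) fzero _ (proj₁ (branch-WellFormed (fsuc i) e e∈Gi))
                                                              (proj₁ (branch-WellFormed fzero e e∈G₀))
    ...   | ()

    open Gluing rest (Gi fzero) (w fzero)
                (attach-WellFormed B B-WellFormed s (Gi ∘ fsuc) (branch-WellFormed ∘ fsuc)) (branch-WellFormed fzero)
                (proj₁ (B⊑attach B s (Gi ∘ fsuc)) (w fzero) (root∈B fzero)) (root∈branch fzero) meet edge-disjoint
      public using (fc-glue; Fc-glue)

  fc-attach : ∀ s {w Gi} → Branches B w Gi → ∀ ws {v₀} → v₀ ∈ ws → (∀ v → v ∈ ws → v ∈V B) →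
              fc (attach B s Gi) ws ≡ expansion (fc B) s w (branchWeight w Gi) ws
  fc-attach zero _ ws _ _ = sym (trans (+-identityʳ _) (trans (*-identityʳ _) (cong (fc B) (++-identityʳ ws))))
  fc-attach (suc s) {w} {Gi} br ws v₀∈ws ws⊆B = begin
    fc (attach B (suc s) Gi) ws
      ≡⟨ fc-glue ws v₀∈ws (λ v v∈ws → proj₁ (B⊑attach B s (Gi ∘ fsuc)) v (ws⊆B v v∈ws)) ⟩
    fc rest ws + fc rest (ws ++ [ w fzero ]) * branchWeight w Gi fzero
      ≡⟨ cong₂ (λ a b → a + b * branchWeight w Gi fzero)
               (fc-attach s (branches-tail B br) ws v₀∈ws ws⊆B)
               (fc-attach s (branches-tail B br) (ws ++ [ w fzero ]) (∈-++⁺ˡ v₀∈ws) ws+w⊆B) ⟩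
    expansion (fc B) s (w ∘ fsuc) (branchWeight w Gi ∘ fsuc) ws
      + expansion (fc B) s (w ∘ fsuc) (branchWeight w Gi ∘ fsuc) (ws ++ [ w fzero ]) * branchWeight w Gi fzero
      ≡⟨ sym (expansion-suc (fc B) w (branchWeight w Gi) ws) ⟩
    expansion (fc B) (suc s) w (branchWeight w Gi) ws ∎
    where
    open AttachStep br
    ws+w⊆B : ∀ v → v ∈ ws ++ [ w fzero ] → v ∈V B
    ws+w⊆B v m = [ ws⊆B v , (λ { (here refl) → Branches.root∈B br fzero }) ]′ (∈-++⁻ ws m)

  private
    rearrange : ∀ a b c m d → a + b + c + m + d ≡ a + (d + b) + (m + c)
    rearrange = solve 5 (λ a b c m d → a :+ b :+ c :+ m :+ d := a :+ (d :+ b) :+ (m :+ c)) refl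
      where open +-*-Solver

  Fc-attach : ∀ s {w Gi} → Branches B w Gi →
              Fc (attach B s Gi) ≡ Fc B + sum (map (λ i → Fc (Gi i) ∸ fc (Gi i) [ w i ]) (allFin s))
                                      + Σ⊆[≥ 1 ] s (term (fc B) w (branchWeight w Gi) [])
  Fc-attach zero _ = sym (trans (+-identityʳ _) (+-identityʳ _))
  Fc-attach (suc s) {w} {Gi} br = begin
    Fc (attach B (suc s) Gi)
      ≡⟨ Fc-glue ⟩
    Fc rest + fc rest [ w fzero ] * c₀ + d fzero
      ≡⟨ cong₂ (λ a b → a + b * c₀ + d fzero) (Fc-attach s (branches-tail B br))
               (fc-attach s (branches-tail B br) [ w fzero ] (here refl) (λ { v (here refl) → Branches.root∈B br fzero })) ⟩
    Fc B + sum (map (d ∘ fsuc) (allFin s)) + Σ⊆[≥ 1 ] s (term (fc B) (w ∘ fsuc) (c ∘ fsuc) [])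
      + expansion (fc B) s (w ∘ fsuc) (c ∘ fsuc) [ w fzero ] * c₀ + d fzero
      ≡⟨ rearrange (Fc B) _ _ _ _ ⟩
    Fc B + (d fzero + sum (map (d ∘ fsuc) (allFin s)))
      + (expansion (fc B) s (w ∘ fsuc) (c ∘ fsuc) [ w fzero ] * c₀ + Σ⊆[≥ 1 ] s (term (fc B) (w ∘ fsuc) (c ∘ fsuc) []))
      ≡⟨ sym (cong₂ (λ a b → Fc B + a + b) (sum-allFin-suc d) (nonempty-expansion-suc (fc B) w c)) ⟩
    Fc B + sum (map d (allFin (suc s))) + Σ⊆[≥ 1 ] (suc s) (term (fc B) w c []) ∎
    where
    open AttachStep br
    c : Fin (suc s) → ℕ
    c = branchWeight w Gi
    c₀ : ℕ
    c₀ = c fzero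
    d : Fin (suc s) → ℕ
    d i = Fc (Gi i) ∸ fc (Gi i) [ w i ]

  Fc-attach-by-size : ∀ s {w Gi} → Branches B w Gi →
    Fc (attach B s Gi) ≡ Fc B + sum (map (λ i → Fc (Gi i) ∸ 1) (allFin s))
                              + sum (map (λ i → (fc B [ w i ] ∸ 1) * (fc (Gi i) [ w i ] ∸ 1)) (allFin s))
                              + Σ⊆[≥ 2 ] s (term (fc B) w (branchWeight w Gi) [])
  Fc-attach-by-size s {w} {Gi} br = begin
    Fc (attach B s Gi)
      ≡⟨ Fc-attach s br ⟩
    Fc B + D + Σ⊆[≥ 1 ] s (term (fc B) w c [])
      ≡⟨ cong (Fc B + D +_) (nonempty-expansion-singletons (fc B) w c) ⟩
    Fc B + D + (S₁ + S₂)
      ≡⟨ sym (+-assoc (Fc B + D) S₁ S₂) ⟩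
    Fc B + D + S₁ + S₂
      ≡⟨ cong (_+ S₂) (trans (+-assoc (Fc B) D S₁) (trans (cong (Fc B +_) regroup) (sym (+-assoc (Fc B) _ _)))) ⟩
    Fc B + sum (map (λ i → Fc (Gi i) ∸ 1) (allFin s)) + sum (map (λ i → (fc B [ w i ] ∸ 1) * c i) (allFin s)) + S₂ ∎
    where
    open Branches br
    c : Fin s → ℕ
    c = branchWeight w Gi
    D S₁ S₂ : ℕ
    D = sum (map (λ i → Fc (Gi i) ∸ fc (Gi i) [ w i ]) (allFin s))
    S₁ = sum (map (λ i → fc B [ w i ] * c i) (allFin s))
    S₂ = Σ⊆[≥ 2 ] s (term (fc B) w c [])
    regroup : D + S₁ ≡ sum (map (λ i → Fc (Gi i) ∸ 1) (allFin s)) + sum (map (λ i → (fc B [ w i ] ∸ 1) * c i) (allFin s))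
    regroup = regroup-singletons (λ i → Fc (Gi i)) (λ i → fc (Gi i) [ w i ]) (λ i → fc B [ w i ])
                (λ i → fc-positive {H = B} (root∈B i)) (λ i → fc-positive {H = Gi i} (root∈branch i)) (λ i → fc≤Fc (Gi i) [ w i ]) (allFin s)

-- A block and its branches

module _ {n : ℕ} where

  module _ {H : SG n} (t : T (twoConnected H)) where

    twoConnected⇒connected : T (connected H)
    twoConnected⇒connected = proj₁ (to T-∧ (proj₂ (to (T-∧ {3 ≤ᵇ countᵇ (lookup (V H)) (allFin n)}) t)))

    twoConnected⇒deleteVertex : ∀ v → v ∈V H → T (connected (deleteVertex H v))
    twoConnected⇒deleteVertex v v∈H with to T-∨ (T-allFin⁻ _ (proj₂ (to (T-∧ {connected H})
                                           (proj₂ (to (T-∧ {3 ≤ᵇ countᵇ (lookup (V H)) (allFin n)}) t)))) v)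
    ... | inj₁ v∉H = ⊥-elim (T-not⁻ v∉H v∈H)
    ... | inj₂ c = c

    twoConnected⇒order : 3 ≤ countᵇ (lookup (V H)) (allFin n)
    twoConnected⇒order = ≤ᵇ⇒≤ 3 _ (proj₁ (to T-∧ t))

    twoConnected⇒other-vertex : ∀ u → u ∈V H → ∃ λ b → b ∈V H × b ≢ u
    twoConnected⇒other-vertex u u∈H with proj₁ (connected⇒Connected {K = deleteVertex H u} (twoConnected⇒deleteVertex u u∈H))
    ... | b , b∈H-u = b , ∈V-deleteVertex⁻ H u b b∈H-u

  ⇒twoConnected : ∀ {H} → 3 ≤ countᵇ (lookup (V H)) (allFin n) → T (connected H) →
                  (∀ v → v ∈V H → T (connected (deleteVertex H v))) → T (twoConnected H)
  ⇒twoConnected {H} order c c-v = from T-∧ (≤⇒≤ᵇ order , from T-∧ (c , T-allFin⁺ _ pointwise))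
    where
    pointwise : ∀ v → T (not (lookup (V H) v) ∨ connected (deleteVertex H v))
    pointwise v with T? (lookup (V H) v)
    ... | yes v∈H = from (T-∨ {not (lookup (V H) v)}) (inj₂ (c-v v v∈H))
    ... | no v∉H = from T-∨ (inj₁ (T-not⁺ v∉H))

  module _ {G B : SG n} where

    private
      bridge-vertex : ∀ {e : Fin (P n)} → V B ≡ singletonV (end₁ e) ∪ singletonV (end₂ e) → ∀ u → u ∈V edgeGraph e → u ∈V B
      bridge-vertex VB≡ u = subst (u ∈ₛ_) (sym VB≡)

    IsBlock⇒WellFormed : IsBlock G B → WellFormed B
    IsBlock⇒WellFormed (maximal2conn wfB _ _ _) = wf⇒WellFormed {H = B} wfB
    IsBlock⇒WellFormed (bridge e _ VB≡ EB≡ _) e′ e′∈B with ∈-singletonV⁻ e e′ (subst (e′ ∈ₛ_) EB≡ e′∈B)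
    ... | refl = bridge-vertex VB≡ _ (end₁∈edgeGraph {n} e) , bridge-vertex VB≡ _ (end₂∈edgeGraph {n} e)

    IsBlock⇒vertex : IsBlock G B → ∃ λ b → b ∈V B
    IsBlock⇒vertex (maximal2conn _ _ 2conn _) = proj₁ (connected⇒Connected {K = B} (twoConnected⇒connected {H = B} 2conn))
    IsBlock⇒vertex (bridge e _ VB≡ _ _) = end₁ e , bridge-vertex VB≡ _ (end₁∈edgeGraph {n} e)

    IsBlock⇒other-vertex : IsBlock G B → ∀ u → u ∈V B → ∃ λ b → b ∈V B × b ≢ u
    IsBlock⇒other-vertex (maximal2conn _ _ 2conn _) u u∈B = twoConnected⇒other-vertex {H = B} 2conn u u∈B
    IsBlock⇒other-vertex (bridge e _ VB≡ _ _) u u∈B with ∈V-edgeGraph⁻ e u (subst (u ∈ₛ_) VB≡ u∈B)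
    ... | inj₁ refl = end₂ e , bridge-vertex VB≡ _ (end₂∈edgeGraph {n} e) , (λ eq → ends-distinct {n} e (sym eq))
    ... | inj₂ refl = end₁ e , bridge-vertex VB≡ _ (end₁∈edgeGraph {n} e) , ends-distinct {n} e

  IsBlock⇒⊑ : ∀ {EG B} → IsBlock (whole n EG) B → B ⊑ whole n EG
  IsBlock⇒⊑ {EG} {B} (maximal2conn _ B≼G _ _) = ≼⇒⊑ {H = B} {whole n EG} B≼G
  IsBlock⇒⊑ {EG} {B} (bridge e e∈G _ EB≡ _) =
    (λ v _ → ∈-full v) , (λ e′ e′∈B → subst (_∈E whole n EG) (sym (∈-singletonV⁻ e e′ (subst (e′ ∈ₛ_) EB≡ e′∈B))) e∈G)

module BlockStructure {n : ℕ} (EG : Vec Bool (P n)) (B : SG n) (G-connected : T (connected (whole n EG)))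
                      (block : IsBlock (whole n EG) B) where

  G : SG n
  G = whole n EG

  ∈G : ∀ v → v ∈V G
  ∈G = ∈-full

  B-WellFormed : WellFormed B
  B-WellFormed = IsBlock⇒WellFormed block

  B⊑G : B ⊑ G
  B⊑G = IsBlock⇒⊑ block

  B-other-vertex : ∀ u → u ∈V B → ∃ λ b → b ∈V B × b ≢ u
  B-other-vertex = IsBlock⇒other-vertex block

  G∖EB : SG n
  G∖EB = sg (replicate n true) (tabulate (λ e → lookup EG e ∧ not (lookup (E B) e)))

  ∈E-G∖EB⁻ : ∀ e → e ∈E G∖EB → e ∈E G × ¬ e ∈E B
  ∈E-G∖EB⁻ e t = let e∈G , e∉B = to T-∧ (∈-tabulate⁻ (λ e → lookup EG e ∧ not (lookup (E B) e)) e t) in e∈G , T-not⁻ e∉B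

  ∈E-G∖EB⁺ : ∀ e → e ∈E G → ¬ e ∈E B → e ∈E G∖EB
  ∈E-G∖EB⁺ e e∈G e∉B = ∈-tabulate⁺ (λ e → lookup EG e ∧ not (lookup (E B) e)) e (from T-∧ (e∈G , T-not⁺ e∉B))

  ⊑G∖EB : ∀ {K} → K ⊑ G → (∀ e → e ∈E K → ¬ e ∈E B) → K ⊑ G∖EB
  ⊑G∖EB K⊑G off-B = (λ v _ → ∈G v) , (λ e e∈K → ∈E-G∖EB⁺ e (proj₂ K⊑G e e∈K) (off-B e e∈K))

  private
    -- B together with a path outside E(B) between two of its vertices is 2-connected, contradicting maximality.
    module TwoConnectedEar (2conn : T (twoConnected B))
        (maximal : ∀ H → T (wf H) → T (H ≼ G) → T (B ≼ H) → T (twoConnected H) → H ≡ B)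
        {a b} (a≢b : a ≢ b) (a∈B : a ∈V B) (b∈B : b ∈V B) (W : Walk G∖EB a b) where

      path : Walk G∖EB a b
      path = proj₁ (walk-simplify W)

      H : SG n
      H = sg (V B ∪ listSet (vertices path)) (E B ∪ listSet (edges path))

      B⊑H : B ⊑ H
      B⊑H = ⊑-∪ᴳˡ {H = B} {sg (listSet (vertices path)) (listSet (edges path))}

      path-in-H : Σ (Walk H a b) λ q → vertices q ≡ vertices path
      path-in-H = walk-transfer H path (λ {u} m → ∈-∪⁺ʳ (V B) _ u (∈-listSet⁺ (vertices path) u m))
                                 (λ {e} m → ∈-∪⁺ʳ (E B) _ e (∈-listSet⁺ (edges path) e m))
      pathᴴ : Walk H a b
      pathᴴ = proj₁ path-in-H
      pathᴴ-unique : Unique (vertices pathᴴ)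
      pathᴴ-unique = subst Unique (sym (proj₂ path-in-H)) (proj₂ (walk-simplify W))

      on-path : ∀ u → u ∈V H → ¬ u ∈V B → u ∈ vertices pathᴴ
      on-path u u∈H u∉B =
        [ (λ u∈B → ⊥-elim (u∉B u∈B)) , (λ u∈P → subst (u ∈_) (sym (proj₂ path-in-H)) (∈-listSet⁻ (vertices path) u u∈P)) ]′
          (∈-∪⁻ (V B) _ u u∈H)

      H-WellFormed : WellFormed H
      H-WellFormed e e∈H with ∈-∪⁻ (E B) _ e e∈H
      ... | inj₁ e∈B = Data.Product.map (∈-∪⁺ˡ (V B) _ _) (∈-∪⁺ˡ (V B) _ _) (B-WellFormed e e∈B)
      ... | inj₂ e∈P = Data.Product.map (∈-∪⁺ʳ (V B) _ _ ∘ ∈-listSet⁺ (vertices path) _)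
                                        (∈-∪⁺ʳ (V B) _ _ ∘ ∈-listSet⁺ (vertices path) _)
                                        (ends∈vertices path (∈-listSet⁻ (edges path) e e∈P))

      H⊑G : H ⊑ G
      H⊑G = (λ v _ → ∈G v) ,
            λ e e∈H → [ proj₂ B⊑G e , (λ e∈P → proj₁ (∈E-G∖EB⁻ e (edges⊆E path (∈-listSet⁻ (edges path) e e∈P)))) ]′
                        (∈-∪⁻ (E B) _ e e∈H)

      H-connected : T (connected H)
      H-connected = connected-attach {K = B} {H} (twoConnected⇒connected {H = B} 2conn) B⊑H reach-B
        where
        reach-B : ∀ u → u ∈V H → u ∈V B ⊎ (∃ λ r → r ∈V B × Walk H u r)
        reach-B u u∈H with T? (lookup (V B) u)
        ... | yes u∈B = inj₁ u∈B
        ... | no u∉B = inj₂ (b , b∈B , proj₁ (proj₁ (walk-suffix pathᴴ (on-path u u∈H u∉B) pathᴴ-unique)))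

      B-v-connected : ∀ v → T (connected (deleteVertex B v))
      B-v-connected v with T? (lookup (V B) v)
      ... | yes v∈B = twoConnected⇒deleteVertex {H = B} 2conn v v∈B
      ... | no v∉B = subst (T ∘ connected) (sym (deleteVertex-∉ {H = B} B-WellFormed v∉B)) (twoConnected⇒connected {H = B} 2conn)

      H-v-connected : ∀ v → T (connected (deleteVertex H v))
      H-v-connected v = connected-attach {K = deleteVertex B v} {deleteVertex H v} (B-v-connected v) B-v⊑H-v reach-B
        where
        B-v⊑H-v : deleteVertex B v ⊑ deleteVertex H v
        B-v⊑H-v = (λ u t → let u∈B , u≢v = ∈V-deleteVertex⁻ B v u t in ∈V-deleteVertex⁺ H v u (proj₁ B⊑H u u∈B) u≢v)
                , (λ e t → let e∈B , ≢₁ , ≢₂ = ∈E-deleteVertex⁻ B v e t in ∈E-deleteVertex⁺ H v e (proj₂ B⊑H e e∈B) ≢₁ ≢₂)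
        reach-B : ∀ u → u ∈V deleteVertex H v → u ∈V deleteVertex B v ⊎ (∃ λ r → r ∈V deleteVertex B v × Walk (deleteVertex H v) u r)
        reach-B u t with ∈V-deleteVertex⁻ H v u t
        ... | u∈H , u≢v with T? (lookup (V B) u)
        ...   | yes u∈B = inj₁ (∈V-deleteVertex⁺ B v u u∈B u≢v)
        ...   | no u∉B with simple-walk-escape H v pathᴴ pathᴴ-unique (on-path u u∈H u∉B) u≢v
        ...     | inj₁ (a≢v , to-a) = inj₂ (a , ∈V-deleteVertex⁺ B v a a∈B a≢v , to-a)
        ...     | inj₂ (b≢v , to-b) = inj₂ (b , ∈V-deleteVertex⁺ B v b b∈B b≢v , to-b)

      H-twoConnected : T (twoConnected H)
      H-twoConnected = ⇒twoConnected {H = H}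
        (≤-trans (twoConnected⇒order {H = B} 2conn) (countᵇ-mono (proj₁ B⊑H) (allFin n))) H-connected (λ v _ → H-v-connected v)

      absurd : ⊥
      absurd with edges-nonempty a≢b path
      ... | e₀ , e₀∈P = proj₂ (∈E-G∖EB⁻ e₀ (edges⊆E path e₀∈P))
          (subst (e₀ ∈E_) (maximal H (WellFormed⇒wf {H = H} H-WellFormed) (⊑⇒≼ {H = H} {G} H⊑G) (⊑⇒≼ {H = B} {H} B⊑H) H-twoConnected)
                 (∈-∪⁺ʳ (E B) _ e₀ (∈-listSet⁺ (edges path) e₀ e₀∈P)))

    two-of-two : ∀ {A : Set} {a b p q u : A} → a ≢ b → a ≡ p ⊎ a ≡ q → b ≡ p ⊎ b ≡ q → u ≡ p ⊎ u ≡ q → u ≡ a ⊎ u ≡ b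
    two-of-two a≢b (inj₁ refl) (inj₁ refl) _ = ⊥-elim (a≢b refl)
    two-of-two a≢b (inj₂ refl) (inj₂ refl) _ = ⊥-elim (a≢b refl)
    two-of-two _ (inj₁ refl) (inj₂ refl) u = u
    two-of-two _ (inj₂ refl) (inj₁ refl) u = Data.Sum.swap u

    -- Such a walk would reconnect G after the deletion of the bridge.
    module BridgeEar (e₀ : Fin (P n)) (VB≡ : V B ≡ singletonV (end₁ e₀) ∪ singletonV (end₂ e₀)) (EB≡ : E B ≡ singletonV e₀)
        (cut : T (not (connected (deleteEdge G e₀)))) {a b} (a≢b : a ≢ b) (a∈B : a ∈V B) (b∈B : b ∈V B) (W : Walk G∖EB a b) where

      G-e₀ : SG n
      G-e₀ = deleteEdge G e₀

      ∈E-G-e₀⁺ : ∀ e → e ∈E G → e ≢ e₀ → e ∈E G-e₀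
      ∈E-G-e₀⁺ e e∈G e≢e₀ =
        ∈-tabulate⁺ (λ e′ → lookup EG e′ ∧ not ⌊ e′ ≟ e₀ ⌋) e (from T-∧ (e∈G , T-not⁺ (e≢e₀ ∘ toWitness)))

      W′ : Walk G-e₀ a b
      W′ = walk-mono ((λ v t → t) , λ e t → let e∈G , e∉B = ∈E-G∖EB⁻ e t in
                                               ∈E-G-e₀⁺ e e∈G (λ { refl → e∉B (subst (e₀ ∈ₛ_) (sym EB≡) (∈-singletonV⁺ e₀)) })) W

      end-of-e₀ : ∀ {u} → u ∈V B → u ≡ end₁ e₀ ⊎ u ≡ end₂ e₀
      end-of-e₀ {u} u∈B = ∈V-edgeGraph⁻ {n} e₀ u (subst (u ∈ₛ_) VB≡ u∈B)

      joined-by-e₀ : ∀ {x y : Fin n} → Joins e₀ x y → (x ≡ end₁ e₀ ⊎ x ≡ end₂ e₀) × (y ≡ end₁ e₀ ⊎ y ≡ end₂ e₀)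
      joined-by-e₀ (inj₁ (refl , refl)) = inj₁ refl , inj₂ refl
      joined-by-e₀ (inj₂ (refl , refl)) = inj₂ refl , inj₁ refl

      absurd : ⊥
      absurd = T-not⁻ cut (Connected⇒connected ((a , ∈G a) , leave))
        where
        leave : ∀ X → ProperPart G-e₀ X → LeavingEdge G-e₀ X
        leave X (X⊆ , x∈ , (z , _ , z∉X)) with proj₂ (connected⇒Connected {K = G} G-connected) X (X⊆ , x∈ , (z , ∈G z , z∉X))
        ... | leaving {e} {x} {y} e∈G j x∈X y∈G y∉X with e ≟ e₀
        ...   | no e≢e₀ = leaving (∈E-G-e₀⁺ e e∈G e≢e₀) j x∈X y∈G y∉X
        ...   | yes refl with two-of-two {u = x} a≢b (end-of-e₀ a∈B) (end-of-e₀ b∈B) (proj₁ (joined-by-e₀ j))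
                            | two-of-two {u = y} a≢b (end-of-e₀ a∈B) (end-of-e₀ b∈B) (proj₂ (joined-by-e₀ j))
        ...     | inj₁ refl | inj₁ refl = ⊥-elim (y∉X x∈X)
        ...     | inj₂ refl | inj₂ refl = ⊥-elim (y∉X x∈X)
        ...     | inj₁ refl | inj₂ refl = walk-leaves W′ x∈X y∉X
        ...     | inj₂ refl | inj₁ refl = walk-leaves (walk-reverse W′) x∈X y∉X

  ear : ∀ {a b} → a ≢ b → a ∈V B → b ∈V B → ¬ Walk G∖EB a b
  ear = ear′ block
    where
    ear′ : IsBlock G B → ∀ {a b} → a ≢ b → a ∈V B → b ∈V B → ¬ Walk G∖EB a b
    ear′ (maximal2conn _ _ 2conn maximal) a≢b a∈B b∈B W = TwoConnectedEar.absurd 2conn maximal a≢b a∈B b∈B W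
    ear′ (bridge e₀ _ VB≡ EB≡ cut) a≢b a∈B b∈B W = BridgeEar.absurd e₀ VB≡ EB≡ cut a≢b a∈B b∈B W

  meets-B-at-most-once : ∀ {K} → T (connected K) → K ⊑ G → (∀ e → e ∈E K → ¬ e ∈E B) →
                         ∀ a b → a ∈V K → b ∈V K → a ∈V B → b ∈V B → a ≡ b
  meets-B-at-most-once {K} c K⊑G off-B a b a∈K b∈K a∈B b∈B with a ≟ b
  ... | yes a≡b = a≡b
  ... | no a≢b = ⊥-elim (connected⇒¬¬walk {K = K} c a∈K b∈K λ W → ear a≢b a∈B b∈B (walk-mono (⊑G∖EB {K} K⊑G off-B) W))

  -- Removing x separates the vertices reachable from x without using E(B) from the rest of B.
  edge-off-B⇒cut : ∀ {f x y} → x ∈V B → f ∈E G → ¬ f ∈E B → Joins f x y → T (isCut G x)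
  edge-off-B⇒cut {f} {x} {y} x∈B f∈G f∉B j with B-other-vertex x x∈B
  ... | b , b∈B , b≢x = from T-∧ (∈G x , from T-∧ (∃⇒nonemptyᵇ (V G-x) (∈V-deleteVertex⁺ G x b (∈G b) b≢x) , T-not⁺ disconnected))
    where
    G-x : SG n
    G-x = deleteVertex G x
    disconnected : ¬ T (connected G-x)
    disconnected c = ¬¬-characteristic n (Walk G∖EB x) separate
      where
      separate : ¬ (Σ (Vec Bool n) λ R → ∀ u → u ∈ₛ R ⇔ Walk G∖EB x u)
      separate (R , R⇔) = no-leaving (proj₂ (connected⇒Connected {K = G-x} c) Y (Y⊆ , (y , y∈Y) , (b , b∈G-x , b∉Y)))
        where
        Y : Vec Bool n
        Y = tabulate (λ u → lookup R u ∧ not ⌊ u ≟ x ⌋)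
        ∈Y⁻ : ∀ u → u ∈ₛ Y → Walk G∖EB x u × u ≢ x
        ∈Y⁻ u t = let u∈R , u≢x = to T-∧ (∈-tabulate⁻ (λ u → lookup R u ∧ not ⌊ u ≟ x ⌋) u t) in
                  to (R⇔ u) u∈R , (λ eq → T-not⁻ u≢x (fromWitness eq))
        ∈Y⁺ : ∀ u → Walk G∖EB x u → u ≢ x → u ∈ₛ Y
        ∈Y⁺ u p u≢x = ∈-tabulate⁺ (λ u → lookup R u ∧ not ⌊ u ≟ x ⌋) u (from T-∧ (from (R⇔ u) p , T-not⁺ (u≢x ∘ toWitness)))
        Y⊆ : Y ⊆ₛ V G-x
        Y⊆ u t = ∈V-deleteVertex⁺ G x u (∈G u) (proj₂ (∈Y⁻ u t))
        y∈Y : y ∈ₛ Y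
        y∈Y = ∈Y⁺ y (cons f (∈G x) (∈E-G∖EB⁺ f f∈G f∉B) j (nil (∈G y))) (λ eq → Joins-distinct j (sym eq))
        b∈G-x : b ∈V G-x
        b∈G-x = ∈V-deleteVertex⁺ G x b (∈G b) b≢x
        b∉Y : ¬ b ∈ₛ Y
        b∉Y t = ear (λ eq → b≢x (sym eq)) x∈B b∈B (proj₁ (∈Y⁻ b t))
        no-leaving : ¬ LeavingEdge G-x Y
        no-leaving (leaving {g} {p} {q} g∈ j′ p∈Y q∈ q∉Y) with ∈Y⁻ p p∈Y | T? (lookup (E B) g)
        ... | to-p , p≢x | yes g∈B = ear (λ eq → p≢x (sym eq)) x∈B (proj₁ (WellFormed-joins {H = B} B-WellFormed g∈B j′)) to-p
        ... | to-p , p≢x | no g∉B =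
          q∉Y (∈Y⁺ q (walk-snoc g to-p (∈E-G∖EB⁺ g (proj₁ (∈E-deleteVertex⁻ G x g g∈)) g∉B) j′ (∈G q))
                     (proj₂ (∈V-deleteVertex⁻ G x q q∈)))

  module BranchStructure (s : ℕ) (w : Fin s → Fin n) (Gi : Fin s → SG n)
    (w-injective : ∀ i j → w i ≡ w j → i ≡ j)
    (w∈B : ∀ i → w i ∈V B)
    (cut⇒w : ∀ v → v ∈V B → T (isCut G v) → ∃ λ i → w i ≡ v)
    (Gi-wf : ∀ i → T (wf (Gi i)))
    (Gi≼G : ∀ i → T (Gi i ≼ G))
    (Gi-connected : ∀ i → T (connected (Gi i)))
    (Gi∩B : ∀ i → (V (Gi i) ∩ V B) ≡ singletonV (w i))
    (Gi-maximal : ∀ i H → T (wf H) → T (H ≼ G) → T (connected H) → (V H ∩ V B) ≡ singletonV (w i) → T (Gi i ≼ H) → H ≡ Gi i)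
    where

    Gi-WellFormed : ∀ i → WellFormed (Gi i)
    Gi-WellFormed i = wf⇒WellFormed {H = Gi i} (Gi-wf i)

    Gi⊑G : ∀ i → Gi i ⊑ G
    Gi⊑G i = ≼⇒⊑ {H = Gi i} {G} (Gi≼G i)

    Gi-meets-B : ∀ i v → v ∈V Gi i → v ∈V B → v ≡ w i
    Gi-meets-B i v v∈Gi v∈B = ∈-singletonV⁻ (w i) v (subst (v ∈ₛ_) (Gi∩B i) (∈-∩⁺ (V (Gi i)) (V B) v v∈Gi v∈B))

    w∈Gi : ∀ i → w i ∈V Gi i
    w∈Gi i = proj₁ (∈-∩⁻ (V (Gi i)) (V B) (w i) (subst (w i ∈ₛ_) (sym (Gi∩B i)) (∈-singletonV⁺ (w i))))

    Gi-off-B : ∀ i e → e ∈E Gi i → ¬ e ∈E B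
    Gi-off-B i e e∈Gi e∈B = ends-distinct {n} e
      (trans (Gi-meets-B i _ (proj₁ (Gi-WellFormed i e e∈Gi)) (proj₁ (B-WellFormed e e∈B)))
             (sym (Gi-meets-B i _ (proj₂ (Gi-WellFormed i e e∈Gi)) (proj₂ (B-WellFormed e e∈B)))))

    private
      ∪ᴳ-off-B : ∀ {K L : SG n} → (∀ e → e ∈E K → ¬ e ∈E B) → (∀ e → e ∈E L → ¬ e ∈E B) →
                 ∀ e → e ∈E K ∪ᴳ L → ¬ e ∈E B
      ∪ᴳ-off-B {K} {L} K-off L-off e t = [ K-off e , L-off e ]′ (∈-∪⁻ (E K) (E L) e t)

    Gi-disjoint : ∀ i j v → v ∈V Gi i → v ∈V Gi j → i ≡ j
    Gi-disjoint i j v v∈Gi v∈Gj = w-injective i j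
      (meets-B-at-most-once {K = Gi i ∪ᴳ Gi j}
        (connected-∪ᴳ {H = Gi i} {Gi j} v (Gi-connected i) (Gi-connected j) v∈Gi v∈Gj)
        (∪ᴳ-least {H = Gi i} {Gi j} {G} (Gi⊑G i) (Gi⊑G j))
        (∪ᴳ-off-B {Gi i} {Gi j} (Gi-off-B i) (Gi-off-B j))
        (w i) (w j) (∈-∪⁺ˡ (V (Gi i)) (V (Gi j)) (w i) (w∈Gi i)) (∈-∪⁺ʳ (V (Gi i)) (V (Gi j)) (w j) (w∈Gi j)) (w∈B i) (w∈B j))

    Gi-closed : ∀ i {f : Fin (P n)} {u y} → Joins f u y → u ∈V Gi i → f ∈E G → ¬ f ∈E B → y ∈V Gi i × f ∈E Gi i
    Gi-closed i {f} {u} {y} j u∈Gi f∈G f∉B =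
      subst (y ∈V_) K≡Gi (∈-∪⁺ʳ (V (Gi i)) (V Ef) y (proj₂ (joins∈edgeGraph {n} f j))) ,
      subst (f ∈E_) K≡Gi (∈-∪⁺ʳ (E (Gi i)) (E Ef) f (∈-singletonV⁺ f))
      where
      Ef : SG n
      Ef = edgeGraph f
      K : SG n
      K = Gi i ∪ᴳ Ef
      K-connected : T (connected K)
      K-connected = connected-∪ᴳ {H = Gi i} {Ef} u (Gi-connected i) (edgeGraph-connected {n} f) u∈Gi (proj₁ (joins∈edgeGraph {n} f j))
      K⊑G : K ⊑ G
      K⊑G = ∪ᴳ-least {H = Gi i} {Ef} {G} (Gi⊑G i) (edgeGraph-⊑ {n} f {G} (λ e _ → ∈G _ , ∈G _) f∈G)
      K-off-B : ∀ e → e ∈E K → ¬ e ∈E B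
      K-off-B = ∪ᴳ-off-B {Gi i} {Ef} (Gi-off-B i) (λ e e∈Ef → subst (λ e → ¬ e ∈E B) (sym (∈E-edgeGraph⁻ {n} f e e∈Ef)) f∉B)
      w∈K : w i ∈V K
      w∈K = ∈-∪⁺ˡ (V (Gi i)) (V Ef) (w i) (w∈Gi i)
      K∩B : ∀ v → v ∈V K → v ∈V B → v ≡ w i
      K∩B v v∈K v∈B = meets-B-at-most-once {K = K} K-connected K⊑G K-off-B v (w i) v∈K w∈K v∈B (w∈B i)
      K≡Gi : K ≡ Gi i
      K≡Gi = Gi-maximal i K (WellFormed⇒wf {H = K} (WellFormed-∪ᴳ {H = Gi i} {Ef} (Gi-WellFormed i) (edgeGraph-WellFormed {n} f)))
        (⊑⇒≼ {H = K} {G} K⊑G) K-connected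
        (⊆ₛ-antisym (λ v t → let v∈K , v∈B = ∈-∩⁻ (V K) (V B) v t in
                               subst (_∈ₛ singletonV (w i)) (sym (K∩B v v∈K v∈B)) (∈-singletonV⁺ (w i)))
                    (λ v t → subst (_∈ₛ V K ∩ V B) (sym (∈-singletonV⁻ (w i) v t)) (∈-∩⁺ (V K) (V B) (w i) w∈K (w∈B i))))
        (⊑⇒≼ {H = Gi i} {K} (⊑-∪ᴳˡ {H = Gi i} {Ef}))

    private
      M : Vec Bool n
      M = tabulate (λ u → lookup (V B) u ∨ any (λ i → lookup (V (Gi i)) u) (allFin s))

      ∈M⁻ : ∀ u → u ∈ₛ M → u ∈V B ⊎ ∃ λ i → u ∈V Gi i
      ∈M⁻ u t = Data.Sum.map₂ (T-anyFin⁻ (λ i → lookup (V (Gi i)) u))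
                  (to T-∨ (∈-tabulate⁻ (λ u → lookup (V B) u ∨ any (λ i → lookup (V (Gi i)) u) (allFin s)) u t))

      ∈M⁺ : ∀ u → u ∈V B ⊎ (∃ λ i → u ∈V Gi i) → u ∈ₛ M
      ∈M⁺ u h = ∈-tabulate⁺ (λ u → lookup (V B) u ∨ any (λ i → lookup (V (Gi i)) u) (allFin s)) u
                  (from (T-∨ {lookup (V B) u}) (Data.Sum.map₂ (λ (i , u∈Gi) → T-anyFin⁺ (λ i → lookup (V (Gi i)) u) i u∈Gi) h))

    covers-vertices : ∀ v → v ∈V B ⊎ ∃ λ i → v ∈V Gi i
    covers-vertices v with T? (lookup (V B) v) | T-∃Fin? (λ i → lookup (V (Gi i)) v)
    ... | yes v∈B | _ = inj₁ v∈B
    ... | no _ | inj₁ found = inj₂ found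
    ... | no v∉B | inj₂ none with IsBlock⇒vertex block
    ...   | b , b∈B = ⊥-elim (no-leaving (proj₂ (connected⇒Connected {K = G} G-connected) M
                                         ((λ u _ → ∈G u) , (b , ∈M⁺ b (inj₁ b∈B)) , (v , ∈G v , v∉M))))
      where
      v∉M : ¬ v ∈ₛ M
      v∉M t = [ v∉B , (λ (i , v∈Gi) → none i v∈Gi) ]′ (∈M⁻ v t)
      no-leaving : ¬ LeavingEdge G M
      no-leaving (leaving {f} {x} {y} f∈G j x∈M _ y∉M) = [ from-B , from-Gi ]′ (∈M⁻ x x∈M)
        where
        f∉B : ¬ f ∈E B
        f∉B f∈B = y∉M (∈M⁺ y (inj₁ (proj₂ (WellFormed-joins {H = B} B-WellFormed f∈B j))))
        from-Gi : ¬ ∃ λ i → x ∈V Gi i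
        from-Gi (i , x∈Gi) = y∉M (∈M⁺ y (inj₂ (i , proj₁ (Gi-closed i j x∈Gi f∈G f∉B))))
        from-B : ¬ x ∈V B
        from-B x∈B with cut⇒w x x∈B (edge-off-B⇒cut x∈B f∈G f∉B j)
        ... | i , refl = from-Gi (i , w∈Gi i)

    covers-edges : ∀ f → f ∈E G → f ∈E B ⊎ ∃ λ i → f ∈E Gi i
    covers-edges f f∈G with T? (lookup (E B) f)
    ... | yes f∈B = inj₁ f∈B
    ... | no f∉B with covers-vertices (end₁ f) | covers-vertices (end₂ f)
    ...   | inj₂ (i , x∈Gi) | _ = inj₂ (i , proj₂ (Gi-closed i (joins-ends f) x∈Gi f∈G f∉B))
    ...   | inj₁ _ | inj₂ (i , y∈Gi) = inj₂ (i , proj₂ (Gi-closed i (Joins-sym (joins-ends f)) y∈Gi f∈G f∉B))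
    ...   | inj₁ x∈B | inj₁ y∈B = ⊥-elim (ends-distinct {n} f
            (meets-B-at-most-once {K = edgeGraph f} (edgeGraph-connected {n} f) (edgeGraph-⊑ {n} f {G} (λ e _ → ∈G _ , ∈G _) f∈G)
              (λ e e∈ → subst (λ e → ¬ e ∈E B) (sym (∈E-edgeGraph⁻ {n} f e e∈)) f∉B)
              (end₁ f) (end₂ f) (end₁∈edgeGraph {n} f) (end₂∈edgeGraph {n} f) x∈B y∈B))

    branches : Branches B w Gi
    branches = record { branch-WellFormed = Gi-WellFormed ; root∈B = w∈B ; root∈branch = w∈Gi
                      ; branch-meets-B = Gi-meets-B ; branches-disjoint = Gi-disjoint }

    attach≡G : attach B s Gi ≡ G
    attach≡G = ⊑-antisym {H = attach B s Gi} {G}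
      ((λ v _ → ∈G v) , (λ e e∈ → [ proj₂ B⊑G e , (λ (i , e∈Gi) → proj₂ (Gi⊑G i) e e∈Gi) ]′ (attach-edge B s Gi e e∈)))
      ((λ v _ → [ proj₁ (B⊑attach B s Gi) v , (λ (i , v∈Gi) → proj₁ (Gi⊑attach B s Gi i) v v∈Gi) ]′ (covers-vertices v)) ,
       (λ e e∈G → [ proj₂ (B⊑attach B s Gi) e , (λ (i , e∈Gi) → proj₂ (Gi⊑attach B s Gi i) e e∈Gi) ]′ (covers-edges e e∈G)))

proposition2p4 : (n : ℕ) (EG : Vec Bool (P n)) (B : SG n) (s : ℕ)
    (w : Fin s → Fin n) (Gi : Fin s → SG n) →
    -- G = whole n EG is connected with k = numCut G ≥ 1 cut vertices
    T (connected (whole n EG)) → 1 ≤ numCut (whole n EG) →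
    -- B is a block of G
    IsBlock (whole n EG) B →
    -- w_1 … w_s are distinct and are exactly the cut vertices of G lying in B
    (∀ i j → w i ≡ w j → i ≡ j) →
    (∀ i → T (lookup (V B) (w i))) →
    (∀ i → T (isCut (whole n EG) (w i))) →
    (∀ v → T (lookup (V B) v) → T (isCut (whole n EG) v) → ∃ λ i → w i ≡ v) →
    s ≤ numCut (whole n EG) →
    -- G_i is the maximal connected subgraph of G with V(G_i) ∩ V(B) = {w_i}
    (∀ i → T (wf (Gi i))) →
    (∀ i → T (Gi i ≼ whole n EG)) →
    (∀ i → T (connected (Gi i))) →
    (∀ i → (V (Gi i) ∩ V B) ≡ singletonV (w i)) →
    (∀ i H → T (wf H) → T (H ≼ whole n EG) → T (connected H) →
       (V H ∩ V B) ≡ singletonV (w i) → T (Gi i ≼ H) → H ≡ Gi i) →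
    -- (i)
    ((v0 : Fin n) → T (lookup (V B) v0) →
       fc (whole n EG) [ v0 ] ≡
       sum (map (λ S → fc B (v0 ∷ map w (select S)) *
                       product (map (λ i → fc (Gi i) [ w i ] ∸ 1) (select S)))
                (allSubsets s)))
    ×
    -- (ii)
    (Fc (whole n EG) ≡
       Fc B
       + sum (map (λ i → Fc (Gi i) ∸ 1) (allFin s))
       + sum (map (λ i → (fc B [ w i ] ∸ 1) * (fc (Gi i) [ w i ] ∸ 1)) (allFin s))
       + sum (map (λ S → fc B (map w (select S)) *
                       product (map (λ i → fc (Gi i) [ w i ] ∸ 1) (select S)))
                (filterᵇ (λ S → 2 ≤ᵇ length (select S)) (allSubsets s))))
proposition2p4 n EG B s w Gi G-connected _ block w-injective w∈B _ cut⇒w _ Gi-wf Gi≼G Gi-connected Gi∩B Gi-maximal =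
    (λ v₀ v₀∈B → trans (cong (λ K → fc K [ v₀ ]) (sym attach≡G))
                       (fc-attach B-WellFormed s branches [ v₀ ] (here refl) λ { v (here refl) → v₀∈B }))
  , trans (cong Fc (sym attach≡G)) (Fc-attach-by-size B-WellFormed s branches)
  where
  open BlockStructure EG B G-connected block
  open BranchStructure s w Gi w-injective w∈B cut⇒w Gi-wf Gi≼G Gi-connected Gi∩B Gi-maximal
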